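{- (1) Every pointed graph $(X,x_0)$ admits a universal cover. (2) A pointed covering $p\colon(Y,y_0)\to(X,x_0)$ is universal if and only if $Y$ is simply connected.
   Context: Graphs are simple undirected loopless graphs; graph maps send adjacent vertices to equal or adjacent vertices. $I_n$ has vertices $0,\dots,n$ and edges $i\sim i+1$; a path of length $n$ is a graph map $I_n\to X$. The fundamental group $A_1(X,x_0)$ may be taken to be the group of path-homotopy classes of finite loops at $x_0$ (path-components of the quotient of $\coprod_n P_nX(x_0,x_0)$ by reparametrization along surjective order-preserving maps $I_m\to I_n$, where $P_nX(x_0,x_0)$ has loops of length $n$ as vertices, adjacent iff distinct and pointwise equal-or-adjacent), under concatenation. A graph is simply connected if it is path-connected and $A_1(X,x_0)$ is trivial for every vertex $x_0$. A graph map $p\colon Y\to X$ is a covering map if (i) for each vertex $y$, $p$ restricts to a bijection from $y$ together with its neighbours onto $p(y)$ together with its neighbours, and (ii) for all graph maps $u\colon I_3\to Y$, $v\colon I_1\square I_1\to X$ ($I_1\square I_1$ the $4$-cycle on vertex set $\{0,1\}^2$, adjacent iff differing in one coordinate) with $p(u(0))=v(1,0)$, $p(u(1))=v(0,0)$, $p(u(2))=v(0,1)$, $p(u(3))=v(1,1)$, one has $u(0)=u(3)$ or $u(0)\sim u(3)$. A pointed covering of $(X,x_0)$ is a pointed graph map $p\colon(Y,y_0)\to(X,x_0)$ that is a covering map; morphisms of pointed coverings are pointed graph maps $f$ with $p'\circ f=p$; these form the category $\mathsf{Cov}(X,x_0)$. A universal cover is an initial object of $\mathsf{Cov}(X,x_0)$.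 -}

module Defs where

open import Level using (0ℓ)
open import Data.Nat using (ℕ; zero; suc; _≤_)
open import Data.Fin using (Fin; zero; suc; toℕ; fromℕ; inject₁)
open import Data.Bool using (Bool; true; false)
open import Data.Product using (Σ; _×_; _,_; proj₁; proj₂)
open import Data.Sum using (_⊎_; inj₁; inj₂)
open import Relation.Nullary using (¬_)
open import Relation.Binary.PropositionalEquality using (_≡_; _≢_; refl)
open import Relation.Binary.Structures using (IsEquivalence)
open import Relation.Binary.Construct.Closure.Equivalence using (EqClosure)
open import Function.Bundles using (_⇔_)

-- Vertices form a setoid (Agda has no quotient types; the universal
-- cover has path-homotopy classes as vertices), adjacency is symmetric,
-- irreflexive and respects vertex equality.

record Graph : Set₁ where
  field
    V       : Set
    _≈_     : V → V → Set
    ≈-equiv : IsEquivalence _≈_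
    _~_     : V → V → Set
    ~-sym   : ∀ {x y} → x ~ y → y ~ x
    ~-irr   : ∀ {x y} → x ~ y → ¬ (x ≈ y)
    ~-resp  : ∀ {x x′ y y′} → x ≈ x′ → y ≈ y′ → x ~ y → x′ ~ y′

  _≃~_ : V → V → Set
  x ≃~ y = x ≈ y ⊎ x ~ y

open Graph public

record GraphMap (X Y : Graph) : Set where
  field
    fun     : V X → V Y
    fun-≈   : ∀ {x x′} → _≈_ X x x′ → _≈_ Y (fun x) (fun x′)
    fun-adj : ∀ {x x′} → _~_ X x x′ → _≃~_ Y (fun x) (fun x′)

open GraphMap public

I : ℕ → Graph
I n = record
  { V = Fin (suc n)
  ; _≈_ = _≡_
  ; ≈-equiv = record { refl = refl ; sym = sy ; trans = tr }
  ; _~_ = λ i j → toℕ j ≡ suc (toℕ i) ⊎ toℕ i ≡ suc (toℕ j)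
  ; ~-sym = λ { (inj₁ e) → inj₂ e ; (inj₂ e) → inj₁ e }
  ; ~-irr = irr
  ; ~-resp = λ { refl refl a → a }
  }
  where
  sy : ∀ {a b : Fin (suc n)} → a ≡ b → b ≡ a
  sy refl = refl
  tr : ∀ {a b c : Fin (suc n)} → a ≡ b → b ≡ c → a ≡ c
  tr refl e = e
  noLoop : ∀ (k : ℕ) → ¬ (k ≡ suc k)
  noLoop zero ()
  noLoop (suc k) e = noLoop k (sucInj e)
    where
    sucInj : ∀ {a b : ℕ} → suc a ≡ suc b → a ≡ b
    sucInj refl = refl
  irr : ∀ {i j : Fin (suc n)} →
        (toℕ j ≡ suc (toℕ i) ⊎ toℕ i ≡ suc (toℕ j)) → ¬ (i ≡ j)
  irr {i} (inj₁ e) refl = noLoop (toℕ i) e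
  irr {i} (inj₂ e) refl = noLoop (toℕ i) e

-- The square I_1 □ I_1: vertex set {0,1}², adjacent iff they differ in
-- exactly one coordinate (false = 0, true = 1).

Square : Graph
Square = record
  { V = Bool × Bool
  ; _≈_ = _≡_
  ; ≈-equiv = record { refl = refl ; sym = sy ; trans = tr }
  ; _~_ = adj
  ; ~-sym = adj-sym
  ; ~-irr = adj-irr
  ; ~-resp = λ { refl refl a → a }
  }
  where
  sy : ∀ {a b : Bool × Bool} → a ≡ b → b ≡ a
  sy refl = refl
  tr : ∀ {a b c : Bool × Bool} → a ≡ b → b ≡ c → a ≡ c
  tr refl e = e
  symB : ∀ {a b : Bool} → a ≡ b → b ≡ a
  symB refl = refl
  neqSym : ∀ {a b : Bool} → a ≢ b → b ≢ a
  neqSym ne e = ne (symB e)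
  adj : Bool × Bool → Bool × Bool → Set
  adj (a , b) (c , d) = (a ≡ c × b ≢ d) ⊎ (a ≢ c × b ≡ d)
  adj-sym : ∀ {x y} → adj x y → adj y x
  adj-sym (inj₁ (e , ne)) = inj₁ (symB e , neqSym ne)
  adj-sym (inj₂ (ne , e)) = inj₂ (neqSym ne , symB e)
  adj-irr : ∀ {x y} → adj x y → ¬ (x ≡ y)
  adj-irr (inj₁ (_ , ne)) refl = ne refl
  adj-irr (inj₂ (ne , _)) refl = ne refl

Path : Graph → ℕ → Set
Path X n = GraphMap (I n) X

Loop : (X : Graph) → V X → ℕ → Set
Loop X x₀ n = Σ (Path X n) λ γ →
  _≈_ X (fun γ zero) x₀ × _≈_ X (fun γ (fromℕ n)) x₀

AnyLoop : (X : Graph) → V X → Set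
AnyLoop X x₀ = Σ ℕ (Loop X x₀)

record Reparam (m n : ℕ) : Set where
  field
    r      : Fin (suc m) → Fin (suc n)
    r-mono : ∀ (i j : Fin (suc m)) → toℕ i ≤ toℕ j → toℕ (r i) ≤ toℕ (r j)
    r-surj : ∀ (k : Fin (suc n)) → Σ (Fin (suc m)) λ i → r i ≡ k

-- One-step relations generating path-homotopy:
--   * reparametrisation  δ = γ ∘ r  (δ of length m, γ of length n)
--   * adjacency in P_n X(x₀,x₀): pointwise equal-or-adjacent loops of the
--     same length (pointwise-equal loops are identified, so including them
--     does not change the path components)
data HtpyStep (X : Graph) (x₀ : V X) : AnyLoop X x₀ → AnyLoop X x₀ → Set where
  reparam : ∀ {m n} (ρ : Reparam m n) (δ : Loop X x₀ m) (γ : Loop X x₀ n) →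
            (∀ i → _≈_ X (fun (proj₁ δ) i) (fun (proj₁ γ) (Reparam.r ρ i))) →
            HtpyStep X x₀ (m , δ) (n , γ)
  adjacent : ∀ {n} (γ δ : Loop X x₀ n) →
             (∀ i → _≃~_ X (fun (proj₁ γ) i) (fun (proj₁ δ) i)) →
             HtpyStep X x₀ (n , γ) (n , δ)

-- path-homotopy: the equivalence relation generated (= same path component
-- of the quotient of ∐ₙ P_n X(x₀,x₀) by reparametrisation)
Homotopic : (X : Graph) (x₀ : V X) → AnyLoop X x₀ → AnyLoop X x₀ → Set
Homotopic X x₀ = EqClosure (HtpyStep X x₀)

constLoop : (X : Graph) (x₀ : V X) → AnyLoop X x₀
constLoop X x₀ = 0 , (record { fun = λ _ → x₀
                             ; fun-≈ = λ _ → ≈r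
                             ; fun-adj = λ _ → inj₁ ≈r }) , ≈r , ≈r
  where ≈r = IsEquivalence.refl (≈-equiv X)

A₁-trivial : (X : Graph) → V X → Set
A₁-trivial X x₀ = ∀ (γ : AnyLoop X x₀) → Homotopic X x₀ γ (constLoop X x₀)

PathConnected : Graph → Set
PathConnected X = ∀ (x y : V X) → Σ ℕ λ n → Σ (Path X n) λ γ →
  _≈_ X (fun γ zero) x × _≈_ X (fun γ (fromℕ n)) y

SimplyConnected : Graph → Set
SimplyConnected X = PathConnected X × (∀ (x₀ : V X) → A₁-trivial X x₀)

Fin4 : ℕ → Fin 4
Fin4 zero = zero
Fin4 (suc zero) = suc zero
Fin4 (suc (suc zero)) = suc (suc zero)
Fin4 (suc (suc (suc _))) = suc (suc (suc zero))

record IsCovering {Y X : Graph} (p : GraphMap Y X) : Set where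
  field
    -- (i) p restricts to a bijection N[y] → N[p y] of closed neighbourhoods
    local-inj  : ∀ (y y₁ y₂ : V Y) → _≃~_ Y y y₁ → _≃~_ Y y y₂ →
                 _≈_ X (fun p y₁) (fun p y₂) → _≈_ Y y₁ y₂
    local-surj : ∀ (y : V Y) (x : V X) → _≃~_ X (fun p y) x →
                 Σ (V Y) λ y′ → _≃~_ Y y y′ × _≈_ X (fun p y′) x
    square     : ∀ (u : Path Y 3) (v : GraphMap Square X) →
                 _≈_ X (fun p (fun u (Fin4 0))) (fun v (true , false)) →
                 _≈_ X (fun p (fun u (Fin4 1))) (fun v (false , false)) →
                 _≈_ X (fun p (fun u (Fin4 2))) (fun v (false , true)) →
                 _≈_ X (fun p (fun u (Fin4 3))) (fun v (true , true)) →
                 _≃~_ Y (fun u (Fin4 0)) (fun u (Fin4 3))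

record PtCov (X : Graph) (x₀ : V X) : Set₁ where
  field
    Y     : Graph
    y₀    : V Y
    p     : GraphMap Y X
    p-pt  : _≈_ X (fun p y₀) x₀
    p-cov : IsCovering p

open PtCov public

record CovHom {X : Graph} {x₀ : V X} (C D : PtCov X x₀) : Set where
  field
    f    : GraphMap (Y C) (Y D)
    f-pt : _≈_ (Y D) (fun f (y₀ C)) (y₀ D)
    f-tr : ∀ (y : V (Y C)) → _≈_ X (fun (p D) (fun f y)) (fun (p C) y)

open CovHom public

-- C is an initial object of Cov(X, x₀): a morphism to every D, unique
-- (morphisms equal when their vertex maps agree pointwise)
IsUniversal : {X : Graph} {x₀ : V X} → PtCov X x₀ → Set₁
IsUniversal {X} {x₀} C = ∀ (D : PtCov X x₀) →
  Σ (CovHom C D) λ h → ∀ (g : CovHom C D) →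
    ∀ (y : V (Y C)) → _≈_ (Y D) (fun (f g) y) (fun (f h) y)

-- Paths are handled as walks, an ℕ-indexed chain of vertices with a length,
-- and homotopy as the equivalence generated by monotone reindexing and
-- pointwise adjacency; on loops this is the path-homotopy of the statement,
-- and walks carry concatenation, reversal and the groupoid laws.
--
-- A covering lifts walks uniquely from any point over their start, and its
-- square condition makes lifting preserve pointwise adjacency, hence
-- homotopy.  So if C is simply connected, sending y to the end of the lift
-- to D of the image of a walk from y₀ to y is a well-defined morphism C → D,
-- and the only one.  Homotopy classes of walks from x₀, adjacent when one is
-- the other extended by an edge, form a simply connected covering, hence a
-- universal one; a universal C is isomorphic to it, so simply connected too.

module Submission where

open import Defs
open import Data.Bool using (Bool; true; false)
open import Data.Empty using (⊥; ⊥-elim)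
open import Data.Fin using (Fin; zero; suc; toℕ; fromℕ; fromℕ<)
open import Data.Fin.Properties using (toℕ-injective; toℕ-fromℕ<; toℕ-fromℕ; toℕ≤pred[n])
open import Data.Nat using (ℕ; zero; suc; _+_; _∸_; _≤_; _<_; z≤n; s≤s; _⊔_; _≤?_)
open import Data.Nat.Properties
open import Data.Product using (Σ; _×_; _,_; proj₁; proj₂)
open import Data.Product.Relation.Binary.Pointwise.NonDependent using (×-isEquivalence)
open import Data.Sum using (_⊎_; inj₁; inj₂)
open import Function.Bundles using (_⇔_; mk⇔)
open import Level using (0ℓ)
open import Relation.Binary.Core using (Rel)
open import Relation.Binary.Definitions using (Reflexive; Symmetric)
open import Relation.Binary.PropositionalEquality
  using (_≡_; _≢_; refl; sym; trans; cong; subst; subst₂)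
open import Relation.Binary.Structures using (IsEquivalence)
open import Relation.Binary.Construct.Closure.Equivalence using (EqClosure)
import Relation.Binary.Construct.Closure.Equivalence as EqClosure
open import Relation.Binary.Construct.Closure.ReflexiveTransitive using (ε; _◅_; _◅◅_)
open import Relation.Binary.Construct.Closure.Symmetric using (fwd; bwd)
open import Relation.Nullary using (¬_; yes; no)
import Relation.Binary.Reasoning.Setoid

module _ (X : Graph) where
  open IsEquivalence (≈-equiv X) public
    using () renaming (refl to ≈-refl; reflexive to ≈-reflexive; sym to ≈-sym; trans to ≈-trans)

  ≃~-refl : ∀ {a} → _≃~_ X a a
  ≃~-refl = inj₁ ≈-refl

  ≃~-sym : ∀ {a b} → _≃~_ X a b → _≃~_ X b a
  ≃~-sym (inj₁ e) = inj₁ (≈-sym e)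
  ≃~-sym (inj₂ e) = inj₂ (~-sym X e)

  ≃~-resp : ∀ {a a′ b b′} → _≈_ X a a′ → _≈_ X b b′ → _≃~_ X a b → _≃~_ X a′ b′
  ≃~-resp e₁ e₂ (inj₁ e) = inj₁ (≈-trans (≈-sym e₁) (≈-trans e e₂))
  ≃~-resp e₁ e₂ (inj₂ e) = inj₂ (~-resp X e₁ e₂ e)

  ≃~-respˡ : ∀ {a a′ b} → _≈_ X a a′ → _≃~_ X a b → _≃~_ X a′ b
  ≃~-respˡ e = ≃~-resp e ≈-refl

  ≃~-respʳ : ∀ {a b b′} → _≈_ X b b′ → _≃~_ X a b → _≃~_ X a b′
  ≃~-respʳ = ≃~-resp ≈-refl

fun-≃~ : ∀ {X Y} (f : GraphMap X Y) {a b} → _≃~_ X a b → _≃~_ Y (fun f a) (fun f b)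
fun-≃~ f (inj₁ e) = inj₁ (fun-≈ f e)
fun-≃~ f (inj₂ e) = fun-adj f e

idᴳ : ∀ {X} → GraphMap X X
idᴳ = record { fun = λ x → x ; fun-≈ = λ e → e ; fun-adj = inj₂ }

_∘ᴳ_ : ∀ {X Y Z} → GraphMap Y Z → GraphMap X Y → GraphMap X Z
g ∘ᴳ f = record { fun = λ x → fun g (fun f x)
                ; fun-≈ = λ e → fun-≈ g (fun-≈ f e)
                ; fun-adj = λ a → fun-≃~ g (fun-adj f a) }

Chain : ∀ {A : Set} → Rel A 0ℓ → (ℕ → A) → Set
Chain R s = ∀ k → R (s k) (s (suc k))

-- the first n + 1 terms of s, followed by t
append : ∀ {A : Set} → ℕ → (ℕ → A) → (ℕ → A) → ℕ → A
append zero    s t zero    = s 0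
append zero    s t (suc k) = t k
append (suc n) s t zero    = s 0
append (suc n) s t (suc k) = append n (λ j → s (suc j)) t k

module _ {A : Set} where
  append-head : ∀ n (s t : ℕ → A) → append n s t 0 ≡ s 0
  append-head zero    s t = refl
  append-head (suc n) s t = refl

  append-≤ : ∀ n (s t : ℕ → A) {k} → k ≤ n → append n s t k ≡ s k
  append-≤ zero    s t {zero}  _         = refl
  append-≤ (suc n) s t {zero}  _         = refl
  append-≤ (suc n) s t {suc k} (s≤s k≤n) = append-≤ n (λ j → s (suc j)) t k≤n

  append-> : ∀ n (s t : ℕ → A) k → append n s t (suc (n + k)) ≡ t k
  append-> zero    s t k = refl
  append-> (suc n) s t k = append-> n (λ j → s (suc j)) t k

  append->₀ : ∀ n (s t : ℕ → A) → append n s t (suc n) ≡ t 0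
  append->₀ n s t = subst (λ i → append n s t (suc i) ≡ t 0) (+-identityʳ n) (append-> n s t 0)

  append->suc : ∀ n (s t : ℕ → A) j → append n s t (suc (suc (n + j))) ≡ t (suc j)
  append->suc n s t j =
    subst (λ i → append n s t (suc i) ≡ t (suc j)) (+-suc n j) (append-> n s t (suc j))

  append-chain : ∀ (R : Rel A 0ℓ) n {s t} → Chain R s → Chain R t → R (s n) (t 0) →
                 Chain R (append n s t)
  append-chain R zero    cs ct j zero    = j
  append-chain R zero    cs ct j (suc k) = ct k
  append-chain R (suc n) {s} {t} cs ct j zero =
    subst (R (s 0)) (sym (append-head n (λ i → s (suc i)) t)) (cs 0)
  append-chain R (suc n) cs ct j (suc k) = append-chain R n (λ i → cs (suc i)) ct j k

  append-assoc : ∀ m n (a b c : ℕ → A) k →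
    append (suc (m + n)) (append m a b) c k ≡ append m a (append n b c) k
  append-assoc zero    n a b c zero    = refl
  append-assoc zero    n a b c (suc k) = refl
  append-assoc (suc m) n a b c zero    = refl
  append-assoc (suc m) n a b c (suc k) = append-assoc m n (λ j → a (suc j)) b c k

  append-const : ∀ n (c : A) k → append n (λ _ → c) (λ _ → c) k ≡ c
  append-const zero    c zero    = refl
  append-const zero    c (suc k) = refl
  append-const (suc n) c zero    = refl
  append-const (suc n) c (suc k) = append-const n c k

append-map : ∀ {A B : Set} (f : A → B) n (s t : ℕ → A) k →
  f (append n s t k) ≡ append n (λ i → f (s i)) (λ i → f (t i)) k
append-map f zero    s t zero    = refl
append-map f zero    s t (suc k) = refl
append-map f (suc n) s t zero    = refl
append-map f (suc n) s t (suc k) = append-map f n (λ i → s (suc i)) t k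

append-pointwise : ∀ {A B : Set} (R : A → B → Set) n {s t s′ t′} →
  (∀ k → R (s k) (s′ k)) → (∀ k → R (t k) (t′ k)) →
  ∀ k → R (append n s t k) (append n s′ t′ k)
append-pointwise R zero    hs ht zero    = hs 0
append-pointwise R zero    hs ht (suc k) = ht k
append-pointwise R (suc n) hs ht zero    = hs 0
append-pointwise R (suc n) hs ht (suc k) = append-pointwise R n (λ j → hs (suc j)) ht k

≤⊎>+ : ∀ k n → k ≤ n ⊎ Σ ℕ λ j → k ≡ suc (n + j)
≤⊎>+ zero    n    = inj₁ z≤n
≤⊎>+ (suc k) zero = inj₂ (k , refl)
≤⊎>+ (suc k) (suc n) with ≤⊎>+ k n
... | inj₁ k≤n     = inj₁ (s≤s k≤n)
... | inj₂ (j , e) = inj₂ (j , cong suc e)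

append-pointwise≤ : ∀ {A B : Set} (R : A → B → Set) n m {s t s′ t′} →
  (∀ k → k ≤ n → R (s k) (s′ k)) → (∀ j → j ≤ m → R (t j) (t′ j)) →
  ∀ k → k ≤ suc (n + m) → R (append n s t k) (append n s′ t′ k)
append-pointwise≤ R n m {s} {t} {s′} {t′} hs ht k k≤ with ≤⊎>+ k n
... | inj₁ k≤n =
  subst₂ R (sym (append-≤ n s t k≤n)) (sym (append-≤ n s′ t′ k≤n)) (hs k k≤n)
... | inj₂ (j , refl) =
  subst₂ R (sym (append-> n s t j)) (sym (append-> n s′ t′ j))
    (ht j (+-cancelˡ-≤ n j m (≤-pred k≤)))

Near : ℕ → ℕ → Set
Near a b = b ≡ a ⊎ b ≡ suc a ⊎ a ≡ suc b

module _ {A : Set} (R : Rel A 0ℓ) (R-refl : Reflexive R) (R-sym : Symmetric R) where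
  reverse-chain : ∀ {s} → Chain R s → ∀ n → Chain R (λ k → s (n ∸ k))
  reverse-chain cs zero    zero    = R-refl
  reverse-chain cs zero    (suc k) = R-refl
  reverse-chain cs (suc n) zero    = R-sym (cs n)
  reverse-chain cs (suc n) (suc k) = reverse-chain cs n k

  chain-near : ∀ {s} → Chain R s → ∀ {a b} → Near a b → R (s a) (s b)
  chain-near cs (inj₁ refl)        = R-refl
  chain-near cs (inj₂ (inj₁ refl)) = cs _
  chain-near cs (inj₂ (inj₂ refl)) = R-sym (cs _)

Near-sym : Symmetric Near
Near-sym (inj₁ refl)        = inj₁ refl
Near-sym (inj₂ (inj₁ refl)) = inj₂ (inj₂ refl)
Near-sym (inj₂ (inj₂ refl)) = inj₂ (inj₁ refl)

suc⊔-step : ∀ a j → suc a ⊔ j ≡ a ⊔ j ⊎ suc a ⊔ j ≡ suc (a ⊔ j)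
suc⊔-step a       zero    = inj₂ (cong suc (sym (⊔-identityʳ a)))
suc⊔-step zero    (suc j) = inj₁ refl
suc⊔-step (suc a) (suc j) with suc⊔-step a j
... | inj₁ e = inj₁ (cong suc e)
... | inj₂ e = inj₂ (cong suc e)

Near-⊔ : ∀ {a b} j → Near a b → Near (a ⊔ j) (b ⊔ j)
Near-⊔ j (inj₁ refl) = inj₁ refl
Near-⊔ {a} j (inj₂ (inj₁ refl)) with suc⊔-step a j
... | inj₁ e = inj₁ e
... | inj₂ e = inj₂ (inj₁ e)
Near-⊔ j (inj₂ (inj₂ refl)) = Near-sym (Near-⊔ j (inj₂ (inj₁ refl)))

-- A walk is a length together with an infinite chain; only its values up
-- to the length matter.
record Walk (X : Graph) : Set where
  constructor walk
  field
    len  : ℕ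
    at   : ℕ → V X
    step : Chain (_≃~_ X) at

open Walk public

module _ {X : Graph} where
  start end : Walk X → V X
  start u = at u 0
  end u = at u (len u)

-- With ρ 0 ≡ 0 these are the order-preserving surjections [0, m] → [0, ρ m].
UnitSteps : (ℕ → ℕ) → ℕ → Set
UnitSteps ρ m = ∀ k → k < m → ρ (suc k) ≡ ρ k ⊎ ρ (suc k) ≡ suc (ρ k)

data Step {X : Graph} (u v : Walk X) : Set where
  reindex   : (ρ : ℕ → ℕ) → ρ 0 ≡ 0 → UnitSteps ρ (len u) → ρ (len u) ≡ len v →
              (∀ k → k ≤ len u → _≈_ X (at u k) (at v (ρ k))) → Step u v
  pointwise : len u ≡ len v → (∀ k → k ≤ len u → _≃~_ X (at u k) (at v k)) →
              _≈_ X (start u) (start v) → _≈_ X (end u) (end v) → Step u v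

infix 4 _≅_
_≅_ : {X : Graph} → Walk X → Walk X → Set
_≅_ = EqClosure Step

single : ∀ {A : Set} {R : A → A → Set} {a b} → R a b → EqClosure R a b
single r = fwd r ◅ ε

≅-sym : ∀ {X} {u v : Walk X} → u ≅ v → v ≅ u
≅-sym = EqClosure.symmetric Step

module ≅-Reasoning {X : Graph} = Relation.Binary.Reasoning.Setoid (EqClosure.setoid (Step {X}))

module _ {X : Graph} where
  step-ends : {u v : Walk X} → Step u v → _≈_ X (start u) (start v) × _≈_ X (end u) (end v)
  step-ends {u} {v} (reindex ρ ρ0 _ ρm h) =
    subst (λ i → _≈_ X (start u) (at v i)) ρ0 (h 0 z≤n) ,
    subst (λ i → _≈_ X (end u) (at v i)) ρm (h (len u) ≤-refl)
  step-ends (pointwise _ _ s e) = s , e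

  ≅-ends : {u v : Walk X} → u ≅ v → _≈_ X (start u) (start v) × _≈_ X (end u) (end v)
  ≅-ends = EqClosure.gfold (×-isEquivalence (≈-equiv X) (≈-equiv X))
             (λ u → start u , end u) step-ends

  ≅-end : {u v : Walk X} → u ≅ v → _≈_ X (end u) (end v)
  ≅-end h = proj₂ (≅-ends h)

  pointwise-≈ : {u v : Walk X} → len u ≡ len v → (∀ k → k ≤ len u → _≈_ X (at u k) (at v k)) →
                Step u v
  pointwise-≈ {u} {v} l h =
    pointwise l (λ k k≤ → inj₁ (h k k≤)) (h 0 z≤n)
      (subst (λ i → _≈_ X (end u) (at v i)) l (h (len u) ≤-refl))

  Step-refl : (u : Walk X) → Step u u
  Step-refl u = pointwise-≈ refl (λ _ _ → ≈-refl X)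

  const : V X → ℕ → Walk X
  const x n = walk n (λ _ → x) (λ _ → ≃~-refl X)

  infixl 5 _++_⟨_⟩
  _++_⟨_⟩ : (u t : Walk X) → _≃~_ X (end u) (start t) → Walk X
  u ++ t ⟨ e ⟩ =
    walk (suc (len u + len t)) (append (len u) (at u) (at t))
         (append-chain (_≃~_ X) (len u) (step u) (step t) e)

  _▷_⟨_⟩ : (u : Walk X) (x : V X) → _≃~_ X (end u) x → Walk X
  u ▷ x ⟨ e ⟩ = u ++ const x 0 ⟨ e ⟩

  reverse : Walk X → Walk X
  reverse u = walk (len u) (λ k → at u (len u ∸ k))
                   (reverse-chain (_≃~_ X) (≃~-refl X) (≃~-sym X) (step u) (len u))

  ++-start : ∀ (u t : Walk X) e → start (u ++ t ⟨ e ⟩) ≡ start u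
  ++-start u t e = append-head (len u) (at u) (at t)

  ++-end : ∀ (u t : Walk X) e → end (u ++ t ⟨ e ⟩) ≡ end t
  ++-end u t e = append-> (len u) (at u) (at t) (len t)

  ▷-end : ∀ (u : Walk X) x e → end (u ▷ x ⟨ e ⟩) ≡ x
  ▷-end u x e = ++-end u (const x 0) e

  reverse-end : ∀ (u : Walk X) → end (reverse u) ≡ start u
  reverse-end u = cong (at u) (n∸n≡0 (len u))

-- Concatenation and lifting need a proof about the endpoints of their
-- argument, which has to be carried along a homotopy.
module _ {A B : Set} {R : A → A → Set} {S : B → B → Set} (P : A → Set)
  (P-fwd : ∀ {a b} → R a b → P a → P b) (P-bwd : ∀ {a b} → R a b → P b → P a)
  (f : (a : A) → P a → B)
  (f-irr : ∀ a (p q : P a) → EqClosure S (f a p) (f a q))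
  (f-step : ∀ {a b} → R a b → (p : P a) (q : P b) → EqClosure S (f a p) (f b q)) where
  gmap-invariant : ∀ {a b} → EqClosure R a b → (p : P a) (q : P b) → EqClosure S (f a p) (f b q)
  gmap-invariant ε            p q = f-irr _ p q
  gmap-invariant (fwd r ◅ rs) p q = f-step r p (P-fwd r p) ◅◅ gmap-invariant rs (P-fwd r p) q
  gmap-invariant (bwd r ◅ rs) p q =
    EqClosure.symmetric S (f-step r (P-bwd r p) p) ◅◅ gmap-invariant rs (P-bwd r p) q

unitStep-≤ : ∀ {a b} → b ≡ a ⊎ b ≡ suc a → a ≤ b
unitStep-≤ (inj₁ refl) = ≤-refl
unitStep-≤ (inj₂ refl) = n≤1+n _

unitSteps-mono : ∀ {ρ m} → UnitSteps ρ m → ∀ {k k′} → k ≤ k′ → k′ ≤ m → ρ k ≤ ρ k′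
unitSteps-mono st {k′ = zero} z≤n _ = ≤-refl
unitSteps-mono st {k} {suc k′} k≤ k′<m with m≤n⇒m<n∨m≡n k≤
... | inj₂ refl       = ≤-refl
... | inj₁ (s≤s k≤k′) =
  ≤-trans (unitSteps-mono st k≤k′ (≤-trans (n≤1+n _) k′<m)) (unitStep-≤ (st k′ k′<m))

unitSteps-≤ : ∀ {ρ m n} → UnitSteps ρ m → ρ m ≡ n → ∀ {k} → k ≤ m → ρ k ≤ n
unitSteps-≤ st refl k≤m = unitSteps-mono st k≤m ≤-refl

id-unitSteps : ∀ n → UnitSteps (λ k → k) n
id-unitSteps n k _ = inj₂ refl

append-unitSteps : ∀ n m {ρ τ} → UnitSteps ρ n → UnitSteps τ m → τ 0 ≡ ρ n ⊎ τ 0 ≡ suc (ρ n) →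
                   UnitSteps (append n ρ τ) (suc (n + m))
append-unitSteps n m {ρ} {τ} stρ stτ seam k k< with ≤⊎>+ k n
... | inj₂ (j , refl) rewrite append->suc n ρ τ j | append-> n ρ τ j =
  stτ j (+-cancelˡ-< n j m (≤-pred k<))
... | inj₁ k≤n with m≤n⇒m<n∨m≡n k≤n
...   | inj₁ k<n rewrite append-≤ n ρ τ k<n | append-≤ n ρ τ k≤n = stρ k k<n
...   | inj₂ refl rewrite append->₀ n ρ τ | append-≤ n ρ τ k≤n = seam

-- A step in one factor of a concatenation is a step of the concatenation:
-- a reindexing is extended by the identity on the other factor.
module _ {X : Graph} where
  ++-congˡ-step : ∀ {u u′ : Walk X} (t : Walk X) e e′ → Step u u′ →
                  Step (u ++ t ⟨ e ⟩) (u′ ++ t ⟨ e′ ⟩)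
  ++-congˡ-step {u} {u′} t e e′ (reindex ρ ρ0 st ρm h) =
    reindex (append (len u) ρ τ) (trans (append-head (len u) ρ τ) ρ0)
      (append-unitSteps (len u) (len t) st (λ k _ → inj₂ (cong suc (+-suc (len u′) k)))
         (inj₂ (cong suc (trans (+-identityʳ _) (sym ρm)))))
      (append-> (len u) ρ τ (len t))
      values
    where
    τ : ℕ → ℕ
    τ j = suc (len u′ + j)
    w = append (len u′) (at u′) (at t)
    values : ∀ k → k ≤ suc (len u + len t) →
             _≈_ X (append (len u) (at u) (at t) k) (w (append (len u) ρ τ k))
    values k k≤ = subst (_≈_ X _) (sym (append-map w (len u) ρ τ k))
      (append-pointwise≤ (_≈_ X) (len u) (len t)
        (λ i i≤ → subst (_≈_ X _) (sym (append-≤ (len u′) (at u′) (at t) (unitSteps-≤ st ρm i≤)))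
                    (h i i≤))
        (λ j _ → ≈-reflexive X (sym (append-> (len u′) (at u′) (at t) j))) k k≤)
  ++-congˡ-step {walk n s _} {walk .n s′ _} t e e′ (pointwise refl h s0 _) =
    pointwise refl (append-pointwise≤ (_≃~_ X) n (len t) h (λ _ _ → ≃~-refl X))
      (subst₂ (_≈_ X) (sym (append-head n s (at t))) (sym (append-head n s′ (at t))) s0)
      (subst₂ (_≈_ X) (sym (append-> n s (at t) (len t))) (sym (append-> n s′ (at t) (len t)))
        (≈-refl X))

  ++-congʳ-step : ∀ (t : Walk X) {u u′ : Walk X} e e′ → Step u u′ →
                  Step (t ++ u ⟨ e ⟩) (t ++ u′ ⟨ e′ ⟩)
  ++-congʳ-step t {u} {u′} e e′ (reindex ρ ρ0 st ρm h) =
    reindex (append (len t) (λ k → k) τ) (append-head (len t) (λ k → k) τ)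
      (append-unitSteps (len t) (len u) (id-unitSteps (len t)) τ-unitSteps
         (inj₂ (cong suc (trans (cong (len t +_) ρ0) (+-identityʳ (len t))))))
      (trans (append-> (len t) (λ k → k) τ (len u)) (cong (λ i → suc (len t + i)) ρm))
      values
    where
    τ : ℕ → ℕ
    τ j = suc (len t + ρ j)
    τ-unitSteps : UnitSteps τ (len u)
    τ-unitSteps k k< with st k k<
    ... | inj₁ eq = inj₁ (cong (λ i → suc (len t + i)) eq)
    ... | inj₂ eq = inj₂ (trans (cong (λ i → suc (len t + i)) eq) (cong suc (+-suc (len t) (ρ k))))
    w = append (len t) (at t) (at u′)
    values : ∀ k → k ≤ suc (len t + len u) →
             _≈_ X (append (len t) (at t) (at u) k) (w (append (len t) (λ k → k) τ k))
    values k k≤ = subst (_≈_ X _) (sym (append-map w (len t) (λ k → k) τ k))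
      (append-pointwise≤ (_≈_ X) (len t) (len u)
        (λ i i≤ → ≈-reflexive X (sym (append-≤ (len t) (at t) (at u′) i≤)))
        (λ j j≤ → subst (_≈_ X _) (sym (append-> (len t) (at t) (at u′) (ρ j))) (h j j≤)) k k≤)
  ++-congʳ-step t {walk n s _} {walk .n s′ _} e e′ (pointwise refl h _ se) =
    pointwise refl (append-pointwise≤ (_≃~_ X) (len t) n (λ _ _ → ≃~-refl X) h)
      (subst₂ (_≈_ X) (sym (append-head (len t) (at t) s)) (sym (append-head (len t) (at t) s′))
        (≈-refl X))
      (subst₂ (_≈_ X) (sym (append-> (len t) (at t) s n)) (sym (append-> (len t) (at t) s′ n)) se)

  ++-congˡ : ∀ {u u′ : Walk X} (t : Walk X) → u ≅ u′ → ∀ e e′ → u ++ t ⟨ e ⟩ ≅ u′ ++ t ⟨ e′ ⟩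
  ++-congˡ t h = gmap-invariant (λ w → _≃~_ X (end w) (start t))
    (λ s → ≃~-respˡ X (proj₂ (step-ends s))) (λ s → ≃~-respˡ X (≈-sym X (proj₂ (step-ends s))))
    (λ w e → w ++ t ⟨ e ⟩)
    (λ w e e′ → single (++-congˡ-step t e e′ (Step-refl w)))
    (λ s e e′ → single (++-congˡ-step t e e′ s)) h

  ++-congʳ : ∀ (t : Walk X) {u u′ : Walk X} → u ≅ u′ → ∀ e e′ → t ++ u ⟨ e ⟩ ≅ t ++ u′ ⟨ e′ ⟩
  ++-congʳ t h = gmap-invariant (λ w → _≃~_ X (end t) (start w))
    (λ s → ≃~-respʳ X (proj₁ (step-ends s))) (λ s → ≃~-respʳ X (≈-sym X (proj₁ (step-ends s))))
    (λ w e → t ++ w ⟨ e ⟩)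
    (λ w e e′ → single (++-congʳ-step t e e′ (Step-refl w)))
    (λ s e e′ → single (++-congʳ-step t e e′ s)) h

module _ {X : Graph} where
  ++-identityˡ : ∀ {x} (ℓ : Walk X) e → _≈_ X x (start ℓ) → const x 0 ++ ℓ ⟨ e ⟩ ≅ ℓ
  ++-identityˡ {x} ℓ e x≈ = single (reindex ρ refl st refl values)
    where
    ρ : ℕ → ℕ
    ρ zero    = 0
    ρ (suc k) = k
    st : UnitSteps ρ (suc (len ℓ))
    st zero    _ = inj₁ refl
    st (suc k) _ = inj₂ refl
    values : ∀ k → k ≤ suc (len ℓ) → _≈_ X (append 0 (λ _ → x) (at ℓ) k) (at ℓ (ρ k))
    values zero    _ = x≈
    values (suc k) _ = ≈-refl X

  ++-identityʳ : ∀ (u : Walk X) {x} e → _≈_ X x (end u) → u ▷ x ⟨ e ⟩ ≅ u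
  ++-identityʳ u {x} e x≈ =
    single (reindex ρ (append-head n (λ k → k) (λ _ → n)) st (append-> n (λ k → k) (λ _ → n) 0)
                    values)
    where
    n = len u
    ρ : ℕ → ℕ
    ρ = append n (λ k → k) (λ _ → n)
    st : UnitSteps ρ (suc (n + 0))
    st = append-unitSteps n 0 (id-unitSteps n) (λ _ ()) (inj₁ refl)
    values : ∀ k → k ≤ suc (n + 0) → _≈_ X (append n (at u) (λ _ → x) k) (at u (ρ k))
    values k k≤ = subst (_≈_ X _) (sym (append-map (at u) n (λ k → k) (λ _ → n) k))
      (append-pointwise≤ (_≈_ X) n 0 (λ _ _ → ≈-refl X) (λ _ _ → x≈) k k≤)

  ++-assoc : ∀ (a b c : Walk X) e₁ e₂ e₃ e₄ →
             (a ++ b ⟨ e₁ ⟩) ++ c ⟨ e₂ ⟩ ≅ a ++ (b ++ c ⟨ e₃ ⟩) ⟨ e₄ ⟩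
  ++-assoc a b c _ _ _ _ = single (pointwise-≈ lengths
    (λ k _ → ≈-reflexive X (append-assoc (len a) (len b) (at a) (at b) (at c) k)))
    where
    lengths : suc (suc (len a + len b) + len c) ≡ suc (len a + suc (len b + len c))
    lengths = cong suc (trans (cong suc (+-assoc (len a) (len b) (len c)))
                              (sym (+-suc (len a) (len b + len c))))

  const-≅ : ∀ x m → const x m ≅ const {X} x 0
  const-≅ x m = single (reindex (λ _ → 0) refl (λ _ _ → inj₁ refl) refl (λ _ _ → ≈-refl X))

⊔-suc-near : ∀ a j → Near (a ⊔ j) (a ⊔ suc j)
⊔-suc-near a j rewrite ⊔-comm a (suc j) | ⊔-comm a j with suc⊔-step j a
... | inj₁ e = inj₁ e
... | inj₂ e = inj₂ (inj₁ e)

-- reverse w ++ w is (up to pointwise equality) w ∘ ψ with ψ running from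
-- len w down to 0 and back; raising the floor of ψ one unit at a time
-- contracts it to the constant walk at end w.
module Contraction {X : Graph} (w : Walk X) where
  private
    n = len w

    ψ : ℕ → ℕ
    ψ = append n (λ k → n ∸ k) (λ k → k)

    ψ-near : Chain Near ψ
    ψ-near = append-chain Near n
      (reverse-chain Near (inj₁ refl) Near-sym {λ k → k} (λ _ → inj₂ (inj₁ refl)) n)
      (λ _ → inj₂ (inj₁ refl)) (inj₁ (sym (n∸n≡0 n)))

    ψ-ends : ∀ {k} → k ≡ 0 ⊎ k ≡ suc (n + n) → ψ k ≡ n
    ψ-ends (inj₁ refl) = append-head n (λ k → n ∸ k) (λ k → k)
    ψ-ends (inj₂ refl) = append-> n (λ k → n ∸ k) (λ k → k) n

    ψ-≤ : ∀ k → k ≤ suc (n + n) → ψ k ≤ n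
    ψ-≤ k k≤ = subst (ψ k ≤_) (append-const n n k)
      (append-pointwise≤ _≤_ n n (λ k _ → m∸n≤m n k) (λ _ j≤ → j≤) k k≤)

    floored : ℕ → Walk X
    floored j = walk (suc (n + n)) (λ k → at w (ψ k ⊔ j))
      (λ k → chain-near (_≃~_ X) (≃~-refl X) (≃~-sym X) (step w) (Near-⊔ j (ψ-near k)))

    floored-0 : ∀ e → reverse w ++ w ⟨ e ⟩ ≅ floored 0
    floored-0 e = single (pointwise-≈ refl (λ k _ →
      subst₂ (_≈_ X) (append-map (at w) n (λ k → n ∸ k) (λ k → k) k)
                     (cong (at w) (sym (⊔-identityʳ (ψ k)))) (≈-refl X)))

    floored-suc : ∀ j → j < n → Step (floored j) (floored (suc j))
    floored-suc j j<n = pointwise refl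
      (λ k _ → chain-near (_≃~_ X) (≃~-refl X) (≃~-sym X) (step w) (⊔-suc-near (ψ k) j))
      (end-value (inj₁ refl)) (end-value (inj₂ refl))
      where
      end-value : ∀ {k} → k ≡ 0 ⊎ k ≡ suc (n + n) → _≈_ X (at w (ψ k ⊔ j)) (at w (ψ k ⊔ suc j))
      end-value k-end rewrite ψ-ends k-end | m≥n⇒m⊔n≡m (<⇒≤ j<n) | m≥n⇒m⊔n≡m j<n = ≈-refl X

    floored-upto : ∀ j → j ≤ n → floored 0 ≅ floored j
    floored-upto zero    _   = ε
    floored-upto (suc j) j<n = floored-upto j (<⇒≤ j<n) ◅◅ single (floored-suc j j<n)

    floored-n : floored n ≅ const (end w) (suc (n + n))
    floored-n = single (pointwise-≈ refl (λ k k≤ →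
      ≈-reflexive X (cong (at w) (m≤n⇒m⊔n≡n (ψ-≤ k k≤)))))

  reverse-++-cancel : ∀ e → reverse w ++ w ⟨ e ⟩ ≅ const (end w) 0
  reverse-++-cancel e =
    floored-0 e ◅◅ floored-upto n ≤-refl ◅◅ floored-n ◅◅ const-≅ (end w) (suc (n + n))

open Contraction public using (reverse-++-cancel)

module _ {X : Graph} where
  open ≅-Reasoning hiding (start)

  ≅-from-++-reverse : ∀ (a b : Walk X) {c} e → _≈_ X c (start b) → _≈_ X (end b) (end a) →
                      a ++ reverse b ⟨ e ⟩ ≅ const c 0 → a ≅ b
  ≅-from-++-reverse a b {c} e c≈ b≈a null = begin
    a                                      ≈⟨ ++-identityʳ a a≃b b≈a ⟨
    a ++ const (end b) 0 ⟨ a≃b ⟩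
      ≈⟨ ++-congʳ a (reverse-++-cancel b e′) a≃rb a≃b ⟨
    a ++ (reverse b ++ b ⟨ e′ ⟩) ⟨ a≃rb ⟩  ≈⟨ ++-assoc a (reverse b) b e e″ e′ a≃rb ⟨
    (a ++ reverse b ⟨ e ⟩) ++ b ⟨ e″ ⟩     ≈⟨ ++-congˡ b null e″ (inj₁ c≈) ⟩
    const c 0 ++ b ⟨ inj₁ c≈ ⟩             ≈⟨ ++-identityˡ b (inj₁ c≈) c≈ ⟩
    b                                      ∎
    where
    a≃b : _≃~_ X (end a) (end b)
    a≃b = inj₁ (≈-sym X b≈a)
    e′ : _≃~_ X (end (reverse b)) (start b)
    e′ = inj₁ (≈-reflexive X (reverse-end b))
    a≃rb : _≃~_ X (end a) (start (reverse b ++ b ⟨ e′ ⟩))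
    a≃rb = inj₁ (subst (_≈_ X (end a)) (sym (++-start (reverse b) b e′)) (≈-sym X b≈a))
    e″ : _≃~_ X (end (a ++ reverse b ⟨ e ⟩)) (start b)
    e″ = subst (λ x → _≃~_ X x (start b)) (sym (++-end a (reverse b) e)) e′

  cancel-prefix : ∀ (c ℓ : Walk X) (c≈ℓ : _≈_ X (end c) (start ℓ)) →
                  c ++ ℓ ⟨ inj₁ c≈ℓ ⟩ ≅ c → ℓ ≅ const (start ℓ) 0
  cancel-prefix c ℓ c≈ℓ absorbed = begin
    ℓ                                  ≈⟨ ++-identityˡ ℓ (inj₁ c≈ℓ) c≈ℓ ⟨
    const (end c) 0 ++ ℓ ⟨ inj₁ c≈ℓ ⟩
      ≈⟨ ++-congˡ ℓ (reverse-++-cancel c rc≃c) rcc≃ℓ (inj₁ c≈ℓ) ⟨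
    (reverse c ++ c ⟨ rc≃c ⟩) ++ ℓ ⟨ rcc≃ℓ ⟩
      ≈⟨ ++-assoc (reverse c) c ℓ rc≃c rcc≃ℓ (inj₁ c≈ℓ) rc≃cℓ ⟩
    reverse c ++ (c ++ ℓ ⟨ inj₁ c≈ℓ ⟩) ⟨ rc≃cℓ ⟩
      ≈⟨ ++-congʳ (reverse c) absorbed rc≃cℓ rc≃c ⟩
    reverse c ++ c ⟨ rc≃c ⟩            ≈⟨ reverse-++-cancel c rc≃c ⟩
    const (end c) 0                    ≈⟨ single (pointwise-≈ refl (λ _ _ → c≈ℓ)) ⟩
    const (start ℓ) 0                  ∎
    where
    rc≃c : _≃~_ X (end (reverse c)) (start c)
    rc≃c = inj₁ (≈-reflexive X (reverse-end c))
    rcc≃ℓ : _≃~_ X (end (reverse c ++ c ⟨ rc≃c ⟩)) (start ℓ)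
    rcc≃ℓ = inj₁ (subst (λ x → _≈_ X x (start ℓ)) (sym (++-end (reverse c) c rc≃c)) c≈ℓ)
    rc≃cℓ : _≃~_ X (end (reverse c)) (start (c ++ ℓ ⟨ inj₁ c≈ℓ ⟩))
    rc≃cℓ = subst (_≃~_ X (end (reverse c))) (sym (++-start c ℓ (inj₁ c≈ℓ))) rc≃c

mapWalk : ∀ {X Y} → GraphMap X Y → Walk X → Walk Y
mapWalk f u = walk (len u) (λ k → fun f (at u k)) (λ k → fun-≃~ f (step u k))

mapWalk-step : ∀ {X Y} (f : GraphMap X Y) {u v} → Step u v → Step (mapWalk f u) (mapWalk f v)
mapWalk-step f (reindex ρ ρ0 st ρm h) = reindex ρ ρ0 st ρm (λ k k≤ → fun-≈ f (h k k≤))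
mapWalk-step f (pointwise l h s0 se)  =
  pointwise l (λ k k≤ → fun-≃~ f (h k k≤)) (fun-≈ f s0) (fun-≈ f se)

mapWalk-≅ : ∀ {X Y} (f : GraphMap X Y) {u v} → u ≅ v → mapWalk f u ≅ mapWalk f v
mapWalk-≅ f = EqClosure.gmap (mapWalk f) (mapWalk-step f)

chain-path : ∀ X {s : ℕ → V X} → Chain (_≃~_ X) s → ∀ n → Path X n
chain-path X {s} cs n = record
  { fun     = λ i → s (toℕ i)
  ; fun-≈   = λ { refl → ≈-refl X }
  ; fun-adj = λ { {i} (inj₁ e) → subst (λ k → _≃~_ X (s (toℕ i)) (s k)) (sym e) (cs (toℕ i))
                ; {x′ = j} (inj₂ e) →
                    ≃~-sym X (subst (λ k → _≃~_ X (s (toℕ j)) (s k)) (sym e) (cs (toℕ j))) } }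

path₃ : ∀ X {a b c d} → _≃~_ X a b → _≃~_ X b c → _≃~_ X c d → Path X 3
path₃ X {a} {b} {c} {d} ab bc cd = chain-path X {vertex} edge 3
  where
  vertex : ℕ → V X
  vertex 0 = a
  vertex 1 = b
  vertex 2 = c
  vertex (suc (suc (suc _))) = d
  edge : Chain (_≃~_ X) vertex
  edge 0 = ab
  edge 1 = bc
  edge 2 = cd
  edge (suc (suc (suc _))) = ≃~-refl X

squareMap : ∀ X {a b c d} → _≃~_ X a b → _≃~_ X a c → _≃~_ X b d → _≃~_ X c d →
            GraphMap Square X
squareMap X {a} {b} {c} {d} ab ac bd cd =
  record { fun = corner ; fun-≈ = λ { refl → ≈-refl X } ; fun-adj = edge }
  where
  corner : Bool × Bool → V X
  corner (false , false) = a
  corner (true  , false) = b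
  corner (false , true)  = c
  corner (true  , true)  = d
  vertical : ∀ i {j j′} → j ≢ j′ → _≃~_ X (corner (i , j)) (corner (i , j′))
  vertical i     {false} {false} j≢j′ = ⊥-elim (j≢j′ refl)
  vertical false {false} {true}  _    = ac
  vertical true  {false} {true}  _    = bd
  vertical false {true}  {false} _    = ≃~-sym X ac
  vertical true  {true}  {false} _    = ≃~-sym X bd
  vertical i     {true}  {true}  j≢j′ = ⊥-elim (j≢j′ refl)
  horizontal : ∀ {i i′} j → i ≢ i′ → _≃~_ X (corner (i , j)) (corner (i′ , j))
  horizontal {false} {false} j     i≢i′ = ⊥-elim (i≢i′ refl)
  horizontal {false} {true}  false _    = ab
  horizontal {false} {true}  true  _    = cd
  horizontal {true}  {false} false _    = ≃~-sym X ab
  horizontal {true}  {false} true  _    = ≃~-sym X cd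
  horizontal {true}  {true}  j     i≢i′ = ⊥-elim (i≢i′ refl)
  edge : ∀ {x y} → _~_ Square x y → _≃~_ X (corner x) (corner y)
  edge {i , j} (inj₁ (refl , j≢j′)) = vertical i j≢j′
  edge {i , j} (inj₂ (i≢i′ , refl)) = horizontal j i≢i′

module Lifting {Y X : Graph} (p : GraphMap Y X) (cov : IsCovering p) where
  open IsCovering cov

  Lifts : (ℕ → V X) → (ℕ → V Y) → Set
  Lifts s M = (∀ k → _≈_ X (fun p (M k)) (s k)) × Chain (_≃~_ Y) M

  lifted-chain : ∀ {s M} → Lifts s M → Chain (_≃~_ X) s
  lifted-chain (over , cM) k = ≃~-resp X (over k) (over (suc k)) (fun-≃~ p (cM k))

  neighbour-unique : ∀ {a a′ b b′} → _≃~_ Y a b → _≈_ Y a a′ → _≃~_ Y a′ b′ →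
                     _≈_ X (fun p b) (fun p b′) → _≈_ Y b b′
  neighbour-unique ab a≈a′ a′b′ = local-inj _ _ _ ab (≃~-respˡ Y (≈-sym Y a≈a′) a′b′)

  module _ (s : ℕ → V X) (cs : Chain (_≃~_ X) s) (y : V Y) (y-over : _≈_ X (fun p y) (s 0))
    where
    private
      Over : ℕ → Set
      Over k = Σ (V Y) λ z → _≈_ X (fun p z) (s k)

      next : ∀ k (z : Over k) →
             Σ (V Y) λ z′ → _≃~_ Y (proj₁ z) z′ × _≈_ X (fun p z′) (s (suc k))
      next k (z , over) = local-surj z (s (suc k)) (≃~-respˡ X (≈-sym X over) (cs k))

      lifted : ∀ k → Over k
      lifted zero    = y , y-over
      lifted (suc k) = proj₁ (next k (lifted k)) , proj₂ (proj₂ (next k (lifted k)))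

    lift-seq : ℕ → V Y
    lift-seq k = proj₁ (lifted k)

    lift-seq-lifts : Lifts s lift-seq
    lift-seq-lifts = (λ k → proj₂ (lifted k)) , (λ k → proj₁ (proj₂ (next k (lifted k))))

  lift : (u : Walk X) (y : V Y) → _≈_ X (fun p y) (start u) → Walk Y
  lift u y e =
    walk (len u) (lift-seq (at u) (step u) y e) (proj₂ (lift-seq-lifts (at u) (step u) y e))

  lift-lifts : ∀ u y e → Lifts (at u) (at (lift u y e))
  lift-lifts u y e = lift-seq-lifts (at u) (step u) y e

  lifts-unique : ∀ {s s′ M M′} → Lifts s M → Lifts s′ M′ → _≈_ Y (M 0) (M′ 0) → ∀ N →
                 (∀ k → k ≤ N → _≈_ X (s k) (s′ k)) → ∀ k → k ≤ N → _≈_ Y (M k) (M′ k)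
  lifts-unique l l′ e0 N h zero    _  = e0
  lifts-unique l l′ e0 N h (suc k) k< =
    neighbour-unique (proj₂ l k) (lifts-unique l l′ e0 N h k (<⇒≤ k<)) (proj₂ l′ k)
      (≈-trans X (proj₁ l (suc k)) (≈-trans X (h (suc k) k<) (≈-sym X (proj₁ l′ (suc k)))))

  lifts-reindex : ∀ {sδ sγ Mδ Mγ} → Lifts sδ Mδ → Lifts sγ Mγ → _≈_ Y (Mδ 0) (Mγ 0) →
    ∀ {ρ m} → ρ 0 ≡ 0 → UnitSteps ρ m → (∀ k → k ≤ m → _≈_ X (sδ k) (sγ (ρ k))) →
    ∀ k → k ≤ m → _≈_ Y (Mδ k) (Mγ (ρ k))
  lifts-reindex {Mγ = Mγ} _ _ e0 ρ0 _ _ zero _ = subst (λ i → _≈_ Y _ (Mγ i)) (sym ρ0) e0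
  lifts-reindex {sδ} {sγ} {Mδ} {Mγ} lδ lγ e0 {ρ} ρ0 st h (suc k) k< =
    advance (st k k<) (≈-trans X (proj₁ lδ (suc k)) (h (suc k) k<))
    where
    IH = lifts-reindex lδ lγ e0 ρ0 st h k (<⇒≤ k<)
    advance : ∀ {i} → i ≡ ρ k ⊎ i ≡ suc (ρ k) → _≈_ X (fun p (Mδ (suc k))) (sγ i) →
              _≈_ Y (Mδ (suc k)) (Mγ i)
    advance (inj₁ refl) over =
      neighbour-unique (proj₂ lδ k) IH (≃~-refl Y) (≈-trans X over (≈-sym X (proj₁ lγ _)))
    advance (inj₂ refl) over =
      neighbour-unique (proj₂ lδ k) IH (proj₂ lγ _) (≈-trans X over (≈-sym X (proj₁ lγ _)))

  -- The square condition, applied to the edges k → k + 1 of both sequences,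
  -- carries adjacency of the lifts from k to k + 1.
  lifts-pointwise : ∀ {sγ sδ Mγ Mδ} → Lifts sγ Mγ → Lifts sδ Mδ → _≈_ Y (Mγ 0) (Mδ 0) → ∀ N →
    (∀ k → k ≤ N → _≃~_ X (sγ k) (sδ k)) → ∀ k → k ≤ N → _≃~_ Y (Mγ k) (Mδ k)
  lifts-pointwise lγ lδ e0 N h zero _ = inj₁ e0
  lifts-pointwise lγ lδ e0 N h (suc k) k< =
    square (path₃ Y (≃~-sym Y (proj₂ lγ k)) (lifts-pointwise lγ lδ e0 N h k (<⇒≤ k<))
                    (proj₂ lδ k))
           (squareMap X (lifted-chain lγ k) (h k (<⇒≤ k<)) (h (suc k) k<) (lifted-chain lδ k))
           (proj₁ lγ (suc k)) (proj₁ lγ k) (proj₁ lδ k) (proj₁ lδ (suc k))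

  lift-step : ∀ {u v} → Step u v → ∀ {y y′} → _≈_ Y y y′ → ∀ e e′ →
              Step (lift u y e) (lift v y′ e′)
  lift-step {u} {v} (reindex ρ ρ0 st ρm h) y≈y′ e e′ =
    reindex ρ ρ0 st ρm (lifts-reindex (lift-lifts u _ e) (lift-lifts v _ e′) y≈y′ ρ0 st h)
  lift-step {u} {v} (pointwise l h _ se) {y} {y′} y≈y′ e e′ =
    pointwise l close y≈y′ (subst (_≈_ Y _) (cong Mv l) ends)
    where
    Mu = at (lift u y e)
    Mv = at (lift v y′ e′)
    close : ∀ k → k ≤ len u → _≃~_ Y (Mu k) (Mv k)
    close = lifts-pointwise (lift-lifts u y e) (lift-lifts v y′ e′) y≈y′ (len u) h
    ends : _≈_ Y (Mu (len u)) (Mv (len u))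
    ends = local-inj (Mu (len u)) (Mu (len u)) (Mv (len u)) (≃~-refl Y) (close (len u) ≤-refl)
      (≈-trans X (proj₁ (lift-lifts u y e) (len u))
        (≈-trans X (subst (_≈_ X (end u)) (cong (at v) (sym l)) se)
                   (≈-sym X (proj₁ (lift-lifts v y′ e′) (len u)))))

  lift-≅ : ∀ {u v} → u ≅ v → ∀ y e e′ → lift u y e ≅ lift v y e′
  lift-≅ h y = gmap-invariant (λ w → _≈_ X (fun p y) (start w))
    (λ s e → ≈-trans X e (proj₁ (step-ends s)))
    (λ s e → ≈-trans X e (≈-sym X (proj₁ (step-ends s))))
    (λ w e → lift w y e)
    (λ w e e′ → single (lift-step (Step-refl w) (≈-refl Y) e e′))
    (λ s e e′ → single (lift-step s (≈-refl Y) e e′)) h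

clamp : ∀ n → ℕ → Fin (suc n)
clamp zero    k       = zero
clamp (suc n) zero    = zero
clamp (suc n) (suc k) = suc (clamp n k)

clamp-0 : ∀ n → clamp n 0 ≡ zero
clamp-0 zero    = refl
clamp-0 (suc n) = refl

clamp-toℕ : ∀ n (i : Fin (suc n)) → clamp n (toℕ i) ≡ i
clamp-toℕ zero    zero    = refl
clamp-toℕ (suc n) zero    = refl
clamp-toℕ (suc n) (suc i) = cong suc (clamp-toℕ n i)

clamp-n : ∀ n → clamp n n ≡ fromℕ n
clamp-n zero    = refl
clamp-n (suc n) = cong suc (clamp-n n)

toℕ-clamp : ∀ n {k} → k ≤ n → toℕ (clamp n k) ≡ k
toℕ-clamp zero    {zero}  _         = refl
toℕ-clamp (suc n) {zero}  _         = refl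
toℕ-clamp (suc n) {suc k} (s≤s k≤n) = cong suc (toℕ-clamp n k≤n)

clamp-step : ∀ n k →
  clamp n (suc k) ≡ clamp n k ⊎ toℕ (clamp n (suc k)) ≡ suc (toℕ (clamp n k))
clamp-step zero    k       = inj₁ refl
clamp-step (suc n) zero    = inj₂ (cong (λ i → suc (toℕ i)) (clamp-0 n))
clamp-step (suc n) (suc k) with clamp-step n k
... | inj₁ e = inj₁ (cong suc e)
... | inj₂ e = inj₂ (cong suc e)

module _ {X : Graph} where
  pathWalk : ∀ {n} → Path X n → Walk X
  pathWalk {n} γ = walk n (λ k → fun γ (clamp n k)) edge
    where
    edge : ∀ k → _≃~_ X (fun γ (clamp n k)) (fun γ (clamp n (suc k)))
    edge k with clamp-step n k
    ... | inj₁ e = inj₁ (≈-reflexive X (cong (fun γ) (sym e)))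
    ... | inj₂ e = fun-adj γ (inj₁ e)

  pathWalk-start : ∀ {n} (γ : Path X n) → start (pathWalk γ) ≡ fun γ zero
  pathWalk-start {n} γ = cong (fun γ) (clamp-0 n)

  pathWalk-end : ∀ {n} (γ : Path X n) → end (pathWalk γ) ≡ fun γ (fromℕ n)
  pathWalk-end {n} γ = cong (fun γ) (clamp-n n)

  loopWalk : ∀ {b} → AnyLoop X b → Walk X
  loopWalk (_ , γ , _) = pathWalk γ

  loopWalk-start : ∀ {b} (ℓ : AnyLoop X b) → _≈_ X (start (loopWalk ℓ)) b
  loopWalk-start (_ , γ , e0 , _) = subst (λ x → _≈_ X x _) (sym (pathWalk-start γ)) e0

  loopWalk-end : ∀ {b} (ℓ : AnyLoop X b) → _≈_ X (end (loopWalk ℓ)) b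
  loopWalk-end (_ , γ , _ , e1) = subst (λ x → _≈_ X x _) (sym (pathWalk-end γ)) e1

  walkLoop : ∀ {b} (u : Walk X) → _≈_ X (start u) b × _≈_ X (end u) b → AnyLoop X b
  walkLoop u (e0 , e1) = len u , chain-path X (step u) (len u) , e0 ,
    subst (λ k → _≈_ X (at u k) _) (sym (toℕ-fromℕ (len u))) e1

unitSteps-surjective : ∀ {ρ} m → ρ 0 ≡ 0 → UnitSteps ρ m → ∀ t → t ≤ ρ m →
                       Σ ℕ λ i → i ≤ m × ρ i ≡ t
unitSteps-surjective zero ρ0 st t t≤ = 0 , z≤n , trans ρ0 (sym (n≤0⇒n≡0 (subst (t ≤_) ρ0 t≤)))
unitSteps-surjective {ρ} (suc m) ρ0 st t t≤ with t ≤? ρ m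
... | yes t≤ρm =
  let (i , i≤ , ρi) = unitSteps-surjective m ρ0 (λ k k< → st k (≤-trans k< (n≤1+n m))) t t≤ρm
  in i , ≤-trans i≤ (n≤1+n m) , ρi
... | no t≰ρm with st m ≤-refl
...   | inj₁ eq = ⊥-elim (t≰ρm (subst (t ≤_) eq t≤))
...   | inj₂ eq = suc m , ≤-refl , ≤-antisym (subst (_≤ t) (sym eq) (≰⇒> t≰ρm)) t≤

module _ {m n : ℕ} (R : Reparam m n) where
  open Reparam R

  reparam-first : toℕ (r zero) ≡ 0
  reparam-first with r-surj zero
  ... | j , rj = n≤0⇒n≡0 (subst (λ i → toℕ (r zero) ≤ toℕ i) rj (r-mono zero j z≤n))

  reparam-last : toℕ (r (fromℕ m)) ≡ n
  reparam-last with r-surj (fromℕ n)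
  ... | j , rj = ≤-antisym (toℕ≤pred[n] (r (fromℕ m)))
    (subst (_≤ toℕ (r (fromℕ m))) (trans (cong toℕ rj) (toℕ-fromℕ n))
      (r-mono j (fromℕ m) (subst (toℕ j ≤_) (sym (toℕ-fromℕ m)) (toℕ≤pred[n] j))))

  -- a monotone surjection cannot skip a value
  reparam-unitStep : ∀ i i′ → toℕ i′ ≡ suc (toℕ i) →
                     toℕ (r i′) ≡ toℕ (r i) ⊎ toℕ (r i′) ≡ suc (toℕ (r i))
  reparam-unitStep i i′ i′≡ with m≤n⇒m<n∨m≡n (r-mono i i′ (subst (toℕ i ≤_) (sym i′≡) (n≤1+n _)))
  ... | inj₂ eq = inj₁ (sym eq)
  ... | inj₁ lt = inj₂ (≤-antisym (≮⇒≥ no-skip) lt)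
    where
    no-skip : ¬ (suc (toℕ (r i)) < toℕ (r i′))
    no-skip gap = missed (r-surj (fromℕ< bound))
      where
      bound : suc (toℕ (r i)) < suc n
      bound = ≤-trans gap (≤-trans (toℕ≤pred[n] (r i′)) (n≤1+n n))
      missed : Σ (Fin (suc m)) (λ j → r j ≡ fromℕ< bound) → ⊥
      missed (j , rj) with toℕ j ≤? toℕ i | trans (cong toℕ rj) (toℕ-fromℕ< bound)
      ... | yes j≤i | rj≡ = 1+n≰n (subst (_≤ toℕ (r i)) rj≡ (r-mono j i j≤i))
      ... | no j≰i  | rj≡ = 1+n≰n (≤-trans gap (subst (toℕ (r i′) ≤_) rj≡
                              (r-mono i′ j (subst (_≤ toℕ j) (sym i′≡) (≰⇒> j≰i)))))

module _ {X : Graph} {b : V X} where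
  htpyStep⇒Step : ∀ {ℓ ℓ′} → HtpyStep X b ℓ ℓ′ → Step (loopWalk ℓ) (loopWalk ℓ′)
  htpyStep⇒Step (adjacent {n} γ δ h) =
    pointwise refl (λ k _ → h (clamp n k))
      (≈-trans X (loopWalk-start (n , γ)) (≈-sym X (loopWalk-start (n , δ))))
      (≈-trans X (loopWalk-end (n , γ)) (≈-sym X (loopWalk-end (n , δ))))
  htpyStep⇒Step (reparam {m} {n} R δ γ h) = reindex ρ ρ0 st ρm values
    where
    open Reparam R
    ρ : ℕ → ℕ
    ρ k = toℕ (r (clamp m k))
    ρ0 : ρ 0 ≡ 0
    ρ0 = trans (cong (λ i → toℕ (r i)) (clamp-0 m)) (reparam-first R)
    ρm : ρ m ≡ n
    ρm = trans (cong (λ i → toℕ (r i)) (clamp-n m)) (reparam-last R)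
    st : UnitSteps ρ m
    st k _ with clamp-step m k
    ... | inj₁ e = inj₁ (cong (λ i → toℕ (r i)) e)
    ... | inj₂ e = reparam-unitStep R (clamp m k) (clamp m (suc k)) e
    values : ∀ k → k ≤ m → _≈_ X (fun (proj₁ δ) (clamp m k)) (fun (proj₁ γ) (clamp n (ρ k)))
    values k _ = subst (λ i → _≈_ X _ (fun (proj₁ γ) i)) (sym (clamp-toℕ n _)) (h (clamp m k))

  Homotopic⇒≅ : ∀ {ℓ ℓ′} → Homotopic X b ℓ ℓ′ → loopWalk ℓ ≅ loopWalk ℓ′
  Homotopic⇒≅ = EqClosure.gmap loopWalk htpyStep⇒Step

  step⇒HtpyStep : ∀ {u v : Walk X} → Step u v → ∀ pu pv →
                  HtpyStep X b (walkLoop u pu) (walkLoop v pv)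
  step⇒HtpyStep {u} {v} (reindex ρ ρ0 st ρm h) _ _ = reparam R _ _ values
    where
    bounded : ∀ (i : Fin (suc (len u))) → ρ (toℕ i) < suc (len v)
    bounded i = s≤s (unitSteps-≤ st ρm (toℕ≤pred[n] i))
    R : Reparam (len u) (len v)
    R = record
      { r      = λ i → fromℕ< (bounded i)
      ; r-mono = λ i j i≤j →
          subst₂ _≤_ (sym (toℕ-fromℕ< (bounded i))) (sym (toℕ-fromℕ< (bounded j)))
            (unitSteps-mono st i≤j (toℕ≤pred[n] j))
      ; r-surj = λ k →
          let (i , i≤ , ρi) = unitSteps-surjective (len u) ρ0 st (toℕ k)
                                (subst (toℕ k ≤_) (sym ρm) (toℕ≤pred[n] k))
          in fromℕ< (s≤s i≤) , toℕ-injective (trans (toℕ-fromℕ< (bounded (fromℕ< (s≤s i≤))))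
                                 (trans (cong ρ (toℕ-fromℕ< (s≤s i≤))) ρi))
      }
    values : ∀ i → _≈_ X (at u (toℕ i)) (at v (toℕ (fromℕ< (bounded i))))
    values i =
      subst (λ k → _≈_ X _ (at v k)) (sym (toℕ-fromℕ< (bounded i))) (h (toℕ i) (toℕ≤pred[n] i))
  step⇒HtpyStep {walk n _ _} {walk .n _ _} (pointwise refl h _ _) _ _ =
    adjacent _ _ (λ i → h (toℕ i) (toℕ≤pred[n] i))

  ≅⇒Homotopic : ∀ {u v : Walk X} → u ≅ v → ∀ pu pv →
                Homotopic X b (walkLoop u pu) (walkLoop v pv)
  ≅⇒Homotopic h = gmap-invariant (λ w → _≈_ X (start w) b × _≈_ X (end w) b)
    (λ s (e0 , e1) → ≈-trans X (≈-sym X (proj₁ (step-ends s))) e0 ,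
                     ≈-trans X (≈-sym X (proj₂ (step-ends s))) e1)
    (λ s (e0 , e1) → ≈-trans X (proj₁ (step-ends s)) e0 , ≈-trans X (proj₂ (step-ends s)) e1)
    walkLoop
    (λ w q q′ → single (step⇒HtpyStep (Step-refl w) q q′))
    (λ s q q′ → single (step⇒HtpyStep s q q′)) h

LoopsNull : (X : Graph) → V X → Set
LoopsNull X c = ∀ (u : Walk X) → _≈_ X (start u) c → _≈_ X (end u) c → u ≅ const c 0

module _ {X : Graph} {c : V X} where
  open ≅-Reasoning hiding (start)

  A₁-trivial⇒LoopsNull : A₁-trivial X c → LoopsNull X c
  A₁-trivial⇒LoopsNull trivial u e0 e1 = begin
    u
      ≈⟨ single (pointwise-≈ refl (λ k k≤ → ≈-reflexive X (cong (at u) (toℕ-clamp (len u) k≤)))) ⟨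
    loopWalk (walkLoop u (e0 , e1))  ≈⟨ Homotopic⇒≅ (trivial (walkLoop u (e0 , e1))) ⟩
    loopWalk (constLoop X c)         ≈⟨ single (pointwise-≈ refl (λ _ _ → ≈-refl X)) ⟩
    const c 0                        ∎

  LoopsNull⇒A₁-trivial : LoopsNull X c → A₁-trivial X c
  LoopsNull⇒A₁-trivial null ℓ@(n , γ , _) =
    single (adjacent _ _ (λ i → inj₁ (≈-reflexive X (cong (fun γ) (sym (clamp-toℕ n i))))))
    ◅◅ ≅⇒Homotopic (null (loopWalk ℓ) (loopWalk-start ℓ) (loopWalk-end ℓ))
         (loopWalk-start ℓ , loopWalk-end ℓ) (≈-refl X , ≈-refl X)
    ◅◅ EqClosure.symmetric (HtpyStep X c) (single (adjacent _ _ (λ _ → ≃~-refl X)))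

module _ {X : Graph} {c : V X} (null : LoopsNull X c) where
  LoopsNull⇒≅ : ∀ (a b : Walk X) → _≈_ X (start a) c → _≈_ X (start b) c →
                _≈_ X (end a) (end b) → a ≅ b
  LoopsNull⇒≅ a b a₀ b₀ a≈b = ≅-from-++-reverse a b a≃rb (≈-sym X b₀) (≈-sym X a≈b)
    (null (a ++ reverse b ⟨ a≃rb ⟩)
      (subst (λ x → _≈_ X x c) (sym (++-start a (reverse b) a≃rb)) a₀)
      (subst (λ x → _≈_ X x c) (sym (trans (++-end a (reverse b) a≃rb) (reverse-end b))) b₀))
    where
    a≃rb : _≃~_ X (end a) (start (reverse b))
    a≃rb = inj₁ a≈b

module _ {X : Graph} where
  ▷-start : ∀ (u : Walk X) x e → start (u ▷ x ⟨ e ⟩) ≡ start u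
  ▷-start u x e = ++-start u (const x 0) e

  ▷-congˡ : ∀ {u u′ : Walk X} x → u ≅ u′ → ∀ e e′ → u ▷ x ⟨ e ⟩ ≅ u′ ▷ x ⟨ e′ ⟩
  ▷-congˡ x = ++-congˡ (const x 0)

  ▷-congʳ : ∀ (u : Walk X) {x x′} e e′ → _≈_ X x x′ → u ▷ x ⟨ e ⟩ ≅ u ▷ x′ ⟨ e′ ⟩
  ▷-congʳ u {x} {x′} e e′ x≈x′ = single (pointwise refl
    (λ k _ → append-pointwise (_≃~_ X) (len u) (λ _ → ≃~-refl X) (λ _ → inj₁ x≈x′) k)
    (≈-reflexive X (trans (▷-start u x e) (sym (▷-start u x′ e′))))
    (subst₂ (_≈_ X) (sym (▷-end u x e)) (sym (▷-end u x′ e′)) x≈x′))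

  ▷-end-≃~ : ∀ (u : Walk X) {x y} (e : _≃~_ X (end u) x) → _≃~_ X x y →
             _≃~_ X (end (u ▷ x ⟨ e ⟩)) y
  ▷-end-≃~ u {x} e = subst (λ z → _≃~_ X z _) (sym (▷-end u x e))

  ▷-backtrack : ∀ (u : Walk X) {a b} e₁ e₂ → _≈_ X b (end u) → (u ▷ a ⟨ e₁ ⟩) ▷ b ⟨ e₂ ⟩ ≅ u
  ▷-backtrack u {a} {b} e₁ e₂ b≈ =
    single (pointwise refl close same-start same-end)
    ◅◅ ++-identityʳ (u ▷ end u ⟨ ≃~-refl X ⟩) (inj₁ u′-end) (≈-sym X u′-end)
    ◅◅ ++-identityʳ u (≃~-refl X) (≈-refl X)
    where
    n = len u
    u′-end : _≈_ X (end (u ▷ end u ⟨ ≃~-refl X ⟩)) (end u)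
    u′-end = ≈-reflexive X (▷-end u (end u) (≃~-refl X))
    close : ∀ k → k ≤ _ →
            _≃~_ X (at ((u ▷ a ⟨ e₁ ⟩) ▷ b ⟨ e₂ ⟩) k)
                   (at ((u ▷ end u ⟨ ≃~-refl X ⟩) ▷ end u ⟨ inj₁ u′-end ⟩) k)
    close k _ = append-pointwise (_≃~_ X) (suc (n + 0))
      (append-pointwise (_≃~_ X) n (λ _ → ≃~-refl X) (λ _ → ≃~-sym X e₁)) (λ _ → inj₁ b≈) k
    same-start = ≈-reflexive X (trans (trans (▷-start (u ▷ a ⟨ e₁ ⟩) b e₂) (▷-start u a e₁))
      (sym (trans (▷-start (u ▷ end u ⟨ ≃~-refl X ⟩) (end u) (inj₁ u′-end))
                  (▷-start u (end u) (≃~-refl X)))))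
    same-end = subst₂ (_≈_ X) (sym (▷-end (u ▷ a ⟨ e₁ ⟩) b e₂))
      (sym (▷-end (u ▷ end u ⟨ ≃~-refl X ⟩) (end u) (inj₁ u′-end))) b≈

  -- The routes w → g → d and w → a → d around a square, padded to
  -- w, g, d, d and w, w, a, d, are pointwise adjacent.
  ▷-square : ∀ (w : Walk X) {a g d} (wa : _≃~_ X (end w) a) (wg : _≃~_ X (end w) g) →
             _≃~_ X a d → ∀ e₁ e₂ → (w ▷ g ⟨ wg ⟩) ▷ d ⟨ e₁ ⟩ ≅ (w ▷ a ⟨ wa ⟩) ▷ d ⟨ e₂ ⟩
  ▷-square w {a} {g} {d} wa wg ad e₁ e₂ =
    ≅-sym (++-identityʳ S (inj₁ S-end) (≈-sym X S-end))
    ◅◅ single (pointwise refl close same-start same-end)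
    ◅◅ ▷-congˡ d (▷-congˡ a (++-identityʳ w (≃~-refl X) (≈-refl X)) wa′ wa) e′ e₂
    where
    n = len w
    S = (w ▷ g ⟨ wg ⟩) ▷ d ⟨ e₁ ⟩
    S-end : _≈_ X (end S) d
    S-end = ≈-reflexive X (▷-end (w ▷ g ⟨ wg ⟩) d e₁)
    W = w ▷ end w ⟨ ≃~-refl X ⟩
    wa′ : _≃~_ X (end W) a
    wa′ = ▷-end-≃~ w (≃~-refl X) wa
    e′ : _≃~_ X (end (W ▷ a ⟨ wa′ ⟩)) d
    e′ = ▷-end-≃~ W wa′ ad
    close : ∀ k → k ≤ _ →
            _≃~_ X (at (S ▷ d ⟨ inj₁ S-end ⟩) k) (at ((W ▷ a ⟨ wa′ ⟩) ▷ d ⟨ e′ ⟩) k)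
    close k _ = append-pointwise (_≃~_ X) (suc (suc (n + 0) + 0))
      (append-pointwise (_≃~_ X) (suc (n + 0))
        (append-pointwise (_≃~_ X) n (λ _ → ≃~-refl X) (λ _ → ≃~-sym X wg))
        (λ _ → ≃~-sym X ad))
      (λ _ → ≃~-refl X) k
    start₃ : ∀ (v : Walk X) {x y z} ex ey ez →
             start (((v ▷ x ⟨ ex ⟩) ▷ y ⟨ ey ⟩) ▷ z ⟨ ez ⟩) ≡ start v
    start₃ v {x} {y} {z} ex ey ez =
      trans (▷-start ((v ▷ x ⟨ ex ⟩) ▷ y ⟨ ey ⟩) z ez)
            (trans (▷-start (v ▷ x ⟨ ex ⟩) y ey) (▷-start v x ex))
    same-start =
      ≈-reflexive X (trans (start₃ w wg e₁ (inj₁ S-end)) (sym (start₃ w (≃~-refl X) wa′ e′)))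
    same-end = ≈-reflexive X (trans (▷-end S d (inj₁ S-end)) (sym (▷-end (W ▷ a ⟨ wa′ ⟩) d e′)))

  ▷-next : ∀ {s} (cs : Chain (_≃~_ X) s) m {x} e → _≈_ X x (s (suc m)) →
             walk {X} m s cs ▷ x ⟨ e ⟩ ≅ walk (suc m) s cs
  ▷-next {s} cs m {x} e x≈ = single (pointwise-≈ (cong suc (+-identityʳ m)) values)
    where
    values : ∀ j → j ≤ suc (m + 0) → _≈_ X (append m s (λ _ → x) j) (s j)
    values j j≤ with ≤⊎>+ j m
    ... | inj₁ j≤m = ≈-reflexive X (append-≤ m s (λ _ → x) j≤m)
    ... | inj₂ (i , refl) with n≤0⇒n≡0 (+-cancelˡ-≤ m i 0 (≤-pred j≤))
    ...   | refl = subst₂ (_≈_ X) (sym (append-> m s (λ _ → x) 0))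
                      (cong (λ z → s (suc z)) (sym (+-identityʳ m))) x≈

WalkFrom : (X : Graph) → V X → Set
WalkFrom X x₀ = Σ (Walk X) λ u → _≈_ X (start u) x₀

extend : ∀ {X x₀} (a : WalkFrom X x₀) (x : V X) → _≃~_ X (end (proj₁ a)) x → WalkFrom X x₀
extend {X} {x₀} (u , u₀) x e = u ▷ x ⟨ e ⟩ , subst (λ z → _≈_ X z x₀) (sym (▷-start u x e)) u₀

module FromSimplyConnected {X : Graph} {x₀ : V X} (C : PtCov X x₀)
                           (sc : SimplyConnected (Y C)) (D : PtCov X x₀) where
  open Lifting (p D) (p-cov D)

  private
    null : LoopsNull (Y C) (y₀ C)
    null = A₁-trivial⇒LoopsNull (proj₂ sc (y₀ C))

    base-over : (a : WalkFrom (Y C) (y₀ C)) →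
                _≈_ X (fun (p D) (y₀ D)) (start (mapWalk (p C) (proj₁ a)))
    base-over (a , a₀) = ≈-trans X (p-pt D) (≈-sym X (≈-trans X (fun-≈ (p C) a₀) (p-pt C)))

    liftImage : WalkFrom (Y C) (y₀ C) → Walk (Y D)
    liftImage a = lift (mapWalk (p C) (proj₁ a)) (y₀ D) (base-over a)

    liftImage-lifts : ∀ a → Lifts (at (mapWalk (p C) (proj₁ a))) (at (liftImage a))
    liftImage-lifts a = lift-lifts (mapWalk (p C) (proj₁ a)) (y₀ D) (base-over a)

    liftImage-end : (a b : WalkFrom (Y C) (y₀ C)) →
                    _≈_ (Y C) (end (proj₁ a)) (end (proj₁ b)) →
                    _≈_ (Y D) (end (liftImage a)) (end (liftImage b))
    liftImage-end (a , a₀) (b , b₀) a≈b =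
      ≅-end (lift-≅ (mapWalk-≅ (p C) (LoopsNull⇒≅ null a b a₀ b₀ a≈b)) (y₀ D) _ _)

    route : V (Y C) → WalkFrom (Y C) (y₀ C)
    route y with proj₁ sc (y₀ C) y
    ... | _ , γ , γ₀ , _ =
      pathWalk γ , subst (λ z → _≈_ (Y C) z (y₀ C)) (sym (pathWalk-start γ)) γ₀

    route-end : ∀ y → _≈_ (Y C) (end (proj₁ (route y))) y
    route-end y with proj₁ sc (y₀ C) y
    ... | _ , γ , _ , γₙ = subst (λ z → _≈_ (Y C) z y) (sym (pathWalk-end γ)) γₙ

  φ : V (Y C) → V (Y D)
  φ y = end (liftImage (route y))

  φ-over : ∀ y → _≈_ X (fun (p D) (φ y)) (fun (p C) y)
  φ-over y = ≈-trans X (proj₁ (liftImage-lifts (route y)) (len (proj₁ (route y))))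
                       (fun-≈ (p C) (route-end y))

  φ-≈ : ∀ {y y′} → _≈_ (Y C) y y′ → _≈_ (Y D) (φ y) (φ y′)
  φ-≈ {y} {y′} y≈y′ =
    liftImage-end (route y) (route y′)
      (≈-trans (Y C) (route-end y) (≈-trans (Y C) y≈y′ (≈-sym (Y C) (route-end y′))))

  -- route y followed by the edge to y′ is a walk to y′, whose lift passes
  -- through φ y just before ending at φ y′.
  φ-adj : ∀ {y y′} → _~_ (Y C) y y′ → _≃~_ (Y D) (φ y) (φ y′)
  φ-adj {y} {y′} y~y′ =
    ≃~-resp (Y D) prefix (liftImage-end extended (route y′) extended-end) last-edge
    where
    a = proj₁ (route y)
    a≃y′ : _≃~_ (Y C) (end a) y′
    a≃y′ = ≃~-respˡ (Y C) (≈-sym (Y C) (route-end y)) (inj₂ y~y′)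
    extended : WalkFrom (Y C) (y₀ C)
    extended = extend (route y) y′ a≃y′
    extended-end : _≈_ (Y C) (end (proj₁ extended)) (end (proj₁ (route y′)))
    extended-end = subst (λ z → _≈_ (Y C) z (end (proj₁ (route y′)))) (sym (▷-end a y′ a≃y′))
                     (≈-sym (Y C) (route-end y′))
    L = liftImage extended
    prefix : _≈_ (Y D) (at L (len a)) (φ y)
    prefix = lifts-unique (liftImage-lifts extended) (liftImage-lifts (route y))
      (≈-refl (Y D)) (len a)
      (λ k k≤ → ≈-reflexive X (cong (fun (p C)) (append-≤ (len a) (at a) _ k≤)))
      (len a) ≤-refl
    last-edge : _≃~_ (Y D) (at L (len a)) (end L)
    last-edge = subst (λ k → _≃~_ (Y D) (at L (len a)) (at L (suc k))) (sym (+-identityʳ (len a)))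
                  (step L (len a))

  φ-pt : _≈_ (Y D) (φ (y₀ C)) (y₀ D)
  φ-pt = liftImage-end (route (y₀ C)) (const (y₀ C) 0 , ≈-refl (Y C)) (route-end (y₀ C))

  hom : CovHom C D
  hom = record
    { f    = record { fun = φ ; fun-≈ = φ-≈ ; fun-adj = φ-adj }
    ; f-pt = φ-pt
    ; f-tr = φ-over
    }

  hom-unique : ∀ (g : CovHom C D) y → _≈_ (Y D) (fun (f g) y) (φ y)
  hom-unique g y = ≈-trans (Y D) (fun-≈ (f g) (≈-sym (Y C) (route-end y)))
    (lifts-unique ((λ k → f-tr g (at a k)) , (λ k → fun-≃~ (f g) (step a k)))
      (liftImage-lifts (route y)) (≈-trans (Y D) (fun-≈ (f g) (proj₂ (route y))) (f-pt g)) (len a)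
      (λ _ _ → ≈-refl X) (len a) ≤-refl)
    where a = proj₁ (route y)

simplyConnected⇒universal : ∀ {X x₀} (C : PtCov X x₀) → SimplyConnected (Y C) → IsUniversal C
simplyConnected⇒universal C sc D = hom , hom-unique
  where open FromSimplyConnected C sc D

module UniversalCover (X : Graph) (x₀ : V X) where
  Based : Set
  Based = WalkFrom X x₀

  tip : Based → V X
  tip a = end (proj₁ a)

  _≈ᵁ_ : Based → Based → Set
  a ≈ᵁ b = proj₁ a ≅ proj₁ b

  _~ᵁ_ : Based → Based → Set
  a ~ᵁ b = Σ (_~_ X (tip a) (tip b)) λ a~b → proj₁ b ≅ proj₁ a ▷ tip b ⟨ inj₂ a~b ⟩

  private
    ▷-tip-congʳ : ∀ (a : Based) {x} e e′ → proj₁ a ▷ x ⟨ e ⟩ ≅ proj₁ a ▷ x ⟨ e′ ⟩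
    ▷-tip-congʳ a e e′ = ▷-congʳ (proj₁ a) e e′ (≈-refl X)

  ~ᵁ-sym : ∀ {a b} → a ~ᵁ b → b ~ᵁ a
  ~ᵁ-sym {a} {b} (a~b , b≅) = ~-sym X a~b , ≅-sym
    (▷-congˡ (tip a) b≅ (inj₂ (~-sym X a~b)) back
     ◅◅ ▷-backtrack (proj₁ a) (inj₂ a~b) back (≈-refl X))
    where
    back : _≃~_ X (end (proj₁ a ▷ tip b ⟨ inj₂ a~b ⟩)) (tip a)
    back = ▷-end-≃~ (proj₁ a) (inj₂ a~b) (inj₂ (~-sym X a~b))

  ~ᵁ-irr : ∀ {a b} → a ~ᵁ b → ¬ (a ≈ᵁ b)
  ~ᵁ-irr (a~b , _) a≅b = ~-irr X a~b (≅-end a≅b)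

  ~ᵁ-resp : ∀ {a a′ b b′} → a ≈ᵁ a′ → b ≈ᵁ b′ → a ~ᵁ b → a′ ~ᵁ b′
  ~ᵁ-resp {a} {a′} {b} {b′} a≅ b≅ (a~b , b≅a▷) = a′~b′ ,
    (≅-sym b≅ ◅◅ b≅a▷
     ◅◅ ▷-congˡ (tip b) a≅ (inj₂ a~b) (inj₂ (~-resp X (≅-end a≅) (≈-refl X) a~b))
     ◅◅ ▷-congʳ (proj₁ a′) _ (inj₂ a′~b′) (≅-end b≅))
    where a′~b′ = ~-resp X (≅-end a≅) (≅-end b≅) a~b

  Û : Graph
  Û = record
    { V       = Based
    ; _≈_     = _≈ᵁ_
    ; ≈-equiv = record { refl  = λ {a} → ε
                       ; sym   = ≅-sym
                       ; trans = _◅◅_ }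
    ; _~_     = _~ᵁ_
    ; ~-sym   = λ {a} {b} → ~ᵁ-sym {a} {b}
    ; ~-irr   = λ {a} {b} → ~ᵁ-irr {a} {b}
    ; ~-resp  = λ {a} {a′} {b} {b′} → ~ᵁ-resp {a} {a′} {b} {b′}
    }

  π : GraphMap Û X
  π = record { fun = tip ; fun-≈ = ≅-end ; fun-adj = λ (a~b , _) → inj₂ a~b }

  ≃~ᵁ⇒▷ : ∀ {a b} → _≃~_ Û a b → ∀ e → proj₁ b ≅ proj₁ a ▷ tip b ⟨ e ⟩
  ≃~ᵁ⇒▷ {a} {b} (inj₁ a≅b) e =
    ≅-sym a≅b ◅◅ ≅-sym (++-identityʳ (proj₁ a) e (≈-sym X (≅-end a≅b)))
  ≃~ᵁ⇒▷ {a} {b} (inj₂ (_ , b≅)) e = b≅ ◅◅ ▷-tip-congʳ a _ e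

  extend-adjacent : ∀ a x (e : _≃~_ X (tip a) x) → _≃~_ Û a (extend a x e)
  extend-adjacent a x e@(inj₁ a≈x) = inj₁ (≅-sym (++-identityʳ (proj₁ a) e (≈-sym X a≈x)))
  extend-adjacent a x e@(inj₂ a~x) =
    inj₂ (a~x′ , ▷-congʳ (proj₁ a) e (inj₂ a~x′) (≈-reflexive X (sym (▷-end (proj₁ a) x e))))
    where a~x′ = subst (_~_ X (tip a)) (sym (▷-end (proj₁ a) x e)) a~x

  π-local-surj : ∀ a x → _≃~_ X (tip a) x → Σ Based λ b → _≃~_ Û a b × _≈_ X (tip b) x
  π-local-surj a x e =
    extend a x e , extend-adjacent a x e , ≈-reflexive X (▷-end (proj₁ a) x e)

  π-local-inj : ∀ a b b′ → _≃~_ Û a b → _≃~_ Û a b′ → _≈_ X (tip b) (tip b′) → b ≈ᵁ b′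
  π-local-inj a b b′ ab ab′ b≈b′ =
    ≃~ᵁ⇒▷ {a} {b} ab (fun-≃~ π {a} {b} ab)
    ◅◅ ▷-congʳ (proj₁ a) (fun-≃~ π {a} {b} ab) (fun-≃~ π {a} {b′} ab′) b≈b′
    ◅◅ ≅-sym (≃~ᵁ⇒▷ {a} {b′} ab′ (fun-≃~ π {a} {b′} ab′))

  -- U₃ is U₁ extended along w → g → d, and U₀ extended to d is U₁ extended
  -- along w → a → d; the two agree by ▷-square.
  π-square : ∀ (u : Path Û 3) (v : GraphMap Square X) →
    _≈_ X (tip (fun u (Fin4 0))) (fun v (true , false)) →
    _≈_ X (tip (fun u (Fin4 1))) (fun v (false , false)) →
    _≈_ X (tip (fun u (Fin4 2))) (fun v (false , true)) →
    _≈_ X (tip (fun u (Fin4 3))) (fun v (true , true)) →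
    _≃~_ Û (fun u (Fin4 0)) (fun u (Fin4 3))
  π-square u v over₀ _ _ over₃ = conclude a≃d
    where
    U₀ = fun u zero
    U₁ = fun u (suc zero)
    U₂ = fun u (suc (suc zero))
    U₃ = fun u (suc (suc (suc zero)))
    U₀U₁ : _≃~_ Û U₀ U₁
    U₀U₁ = fun-adj u {zero} {suc zero} (inj₁ refl)
    U₁U₂ : _≃~_ Û U₁ U₂
    U₁U₂ = fun-adj u {suc zero} {suc (suc zero)} (inj₁ refl)
    U₂U₃ : _≃~_ Û U₂ U₃
    U₂U₃ = fun-adj u {suc (suc zero)} {suc (suc (suc zero))} (inj₁ refl)
    w = proj₁ U₁
    a = tip U₀
    g = tip U₂
    d = tip U₃
    wa : _≃~_ X (end w) a
    wa = fun-≃~ π {U₁} {U₀} (≃~-sym Û {U₀} {U₁} U₀U₁)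
    wg : _≃~_ X (end w) g
    wg = fun-≃~ π {U₁} {U₂} U₁U₂
    gd : _≃~_ X g d
    gd = fun-≃~ π {U₂} {U₃} U₂U₃
    a≃d : _≃~_ X a d
    a≃d = ≃~-resp X (≈-sym X over₀) (≈-sym X over₃)
            (fun-adj v {true , false} {true , true} (inj₁ (refl , λ ())))
    U₃≅ : proj₁ U₃ ≅ proj₁ U₀ ▷ d ⟨ a≃d ⟩
    U₃≅ = ≃~ᵁ⇒▷ {U₂} {U₃} U₂U₃ gd
      ◅◅ ▷-congˡ d (≃~ᵁ⇒▷ {U₁} {U₂} U₁U₂ wg) gd (▷-end-≃~ w wg gd)
      ◅◅ ▷-square w wa wg a≃d (▷-end-≃~ w wg gd) (▷-end-≃~ w wa a≃d)
      ◅◅ ▷-congˡ d (≅-sym (≃~ᵁ⇒▷ {U₁} {U₀} (≃~-sym Û {U₀} {U₁} U₀U₁) wa))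
                   (▷-end-≃~ w wa a≃d) a≃d
    conclude : _≃~_ X a d → _≃~_ Û U₀ U₃
    conclude (inj₁ a≈d) = inj₁ (≅-sym (U₃≅ ◅◅ ++-identityʳ (proj₁ U₀) a≃d (≈-sym X a≈d)))
    conclude (inj₂ a~d) = inj₂ (a~d , U₃≅ ◅◅ ▷-tip-congʳ U₀ a≃d (inj₂ a~d))

  π-covering : IsCovering π
  π-covering = record
    { local-inj  = π-local-inj
    ; local-surj = π-local-surj
    ; square     = π-square
    }

  base : Based
  base = const x₀ 0 , ≈-refl X

  cover : PtCov X x₀
  cover = record { Y = Û ; y₀ = base ; p = π ; p-pt = ≈-refl X ; p-cov = π-covering }

  private
    truncation : Based → ℕ → Based
    truncation (u , u₀) k = walk k (at u) (step u) , u₀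

    truncation-chain : ∀ a → Chain (_≃~_ Û) (truncation a)
    truncation-chain (u , _) k with step u k
    ... | inj₁ uk≈ = inj₁ (≅-sym (++-identityʳ (walk k (at u) (step u)) (inj₁ uk≈) (≈-sym X uk≈))
                          ◅◅ ▷-next (step u) k (inj₁ uk≈) (≈-refl X))
    ... | inj₂ uk~ = inj₂ (uk~ , ≅-sym (▷-next (step u) k (inj₂ uk~) (≈-refl X)))

    truncation-0 : ∀ a b → truncation a 0 ≈ᵁ truncation b 0
    truncation-0 (u , u₀) (v , v₀) =
      single (pointwise-≈ refl λ { zero _ → ≈-trans X u₀ (≈-sym X v₀) ; (suc _) () })

  -- shrink a back to the base point, then grow b
  pathConnected : PathConnected Û
  pathConnected a b = n , chain-path Û {route} route-chain n , route-start , route-end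
    where
    na = len (proj₁ a)
    n = suc (na + len (proj₁ b))
    route : ℕ → Based
    route = append na (λ k → truncation a (na ∸ k)) (truncation b)
    route-chain : Chain (_≃~_ Û) route
    route-chain = append-chain (_≃~_ Û) na
      (reverse-chain (_≃~_ Û) (λ {x} → ≃~-refl Û {x}) (λ {x} {y} → ≃~-sym Û {x} {y})
                     {truncation a} (truncation-chain a) na)
      (truncation-chain b)
      (inj₁ (subst (λ k → truncation a k ≈ᵁ truncation b 0) (sym (n∸n≡0 na)) (truncation-0 a b)))
    route-start : route 0 ≈ᵁ a
    route-start =
      subst (_≈ᵁ a) (sym (append-head na (λ k → truncation a (na ∸ k)) (truncation b))) ε
    route-end : route (toℕ (fromℕ n)) ≈ᵁ b
    route-end = subst (λ k → route k ≈ᵁ b) (sym (toℕ-fromℕ _))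
      (subst (_≈ᵁ b) (sym (append-> na (λ k → truncation a (na ∸ k)) (truncation b) _)) ε)

  open Lifting π π-covering

  -- A loop U at c projects to a walk ℓ with c ++ ℓ ≅ c, since the vertices
  -- of U are the classes of the walks c ++ (initial segments of ℓ); so ℓ is
  -- null-homotopic, and U, its lift, is too.
  module _ (c : Based) (U : Walk Û) (U₀ : start U ≈ᵁ c) (Uₙ : end U ≈ᵁ c) where
    private
      c′ = proj₁ c
      ℓ = mapWalk π U
      c≈ℓ : _≈_ X (end c′) (start ℓ)
      c≈ℓ = ≈-sym X (≅-end U₀)

      s : ℕ → V X
      s = append (len c′) (at c′) (at ℓ)
      cs : Chain (_≃~_ X) s
      cs = append-chain (_≃~_ X) (len c′) (step c′) (step ℓ) (inj₁ c≈ℓ)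

      initial : ℕ → Walk X
      initial m = walk m s cs

      initial-len : ∀ {m m′} → m ≡ m′ → initial m ≅ initial m′
      initial-len refl = ε

      c′≅ : c′ ≅ initial (suc (len c′ + 0))
      c′≅ = single (pointwise-≈ refl λ k k≤ →
              ≈-reflexive X (sym (append-≤ (len c′) (at c′) (at ℓ) k≤)))
        ◅◅ ≅-sym (++-identityʳ (initial (len c′)) (cs (len c′)) s-next)
        ◅◅ ▷-next cs (len c′) (cs (len c′)) (≈-refl X)
        ◅◅ initial-len (cong suc (sym (+-identityʳ (len c′))))
        where
        s-next : _≈_ X (s (suc (len c′))) (s (len c′))
        s-next = subst₂ (_≈_ X) (sym (append->₀ (len c′) (at c′) (at ℓ)))
                   (sym (append-≤ (len c′) (at c′) (at ℓ) ≤-refl)) (≈-sym X c≈ℓ)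

      along : ∀ k → proj₁ (at U k) ≅ initial (suc (len c′ + k))
      along zero    = U₀ ◅◅ c′≅
      along (suc k) =
        ≃~ᵁ⇒▷ {at U k} {at U (suc k)} (step U k) ℓk
        ◅◅ ▷-congˡ (at ℓ (suc k)) (along k) ℓk ℓk′
        ◅◅ ▷-next cs (suc (len c′ + k)) ℓk′
             (≈-reflexive X (sym (append->suc (len c′) (at c′) (at ℓ) k)))
        ◅◅ initial-len (cong suc (sym (+-suc (len c′) k)))
        where
        ℓk : _≃~_ X (at ℓ k) (at ℓ (suc k))
        ℓk = step ℓ k
        ℓk′ : _≃~_ X (end (initial (suc (len c′ + k)))) (at ℓ (suc k))
        ℓk′ = subst (λ z → _≃~_ X z (at ℓ (suc k)))
                (sym (append-> (len c′) (at c′) (at ℓ) k)) ℓk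

      U-lifts : Lifts (at ℓ) (at U)
      U-lifts = (λ _ → ≈-refl X) , step U

      U≅lift : U ≅ lift ℓ c c≈ℓ
      U≅lift = single (pointwise-≈ refl
        (lifts-unique {M = at U} {M′ = at (lift ℓ c c≈ℓ)} U-lifts (lift-lifts ℓ c c≈ℓ) U₀ (len U)
                      (λ _ _ → ≈-refl X)))

      ℓ-null : ℓ ≅ const (start ℓ) 0
      ℓ-null = cancel-prefix c′ ℓ c≈ℓ (≅-sym (along (len U)) ◅◅ Uₙ)

    loop-null : U ≅ const c 0
    loop-null =
      U≅lift ◅◅ lift-≅ ℓ-null c c≈ℓ c≈ℓ ◅◅ single (pointwise-≈ refl λ { zero _ → ε ; (suc _) () })

  simplyConnected : SimplyConnected Û
  simplyConnected = pathConnected , λ c → LoopsNull⇒A₁-trivial {Û} {c} (loop-null c)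

module _ {Z W : Graph} (h : GraphMap Z W) (r : GraphMap W Z)
         (r∘h≈id : ∀ z → _≈_ Z (fun r (fun h z)) z) where
  retract-pathConnected : PathConnected W → PathConnected Z
  retract-pathConnected conn a b with conn (fun h a) (fun h b)
  ... | n , γ , γ₀ , γₙ =
    n , r ∘ᴳ γ , ≈-trans Z (fun-≈ r γ₀) (r∘h≈id a) , ≈-trans Z (fun-≈ r γₙ) (r∘h≈id b)

  retract-LoopsNull : ∀ c → LoopsNull W (fun h c) → LoopsNull Z c
  retract-LoopsNull c null u u₀ uₙ =
    single (pointwise-≈ refl (λ k _ → ≈-sym Z (r∘h≈id (at u k))))
    ◅◅ mapWalk-≅ r (null (mapWalk h u) (fun-≈ h u₀) (fun-≈ h uₙ))
    ◅◅ single (pointwise-≈ refl (λ _ _ → r∘h≈id c))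

  retract-simplyConnected : SimplyConnected W → SimplyConnected Z
  retract-simplyConnected (conn , trivial) =
    retract-pathConnected conn ,
    λ c → LoopsNull⇒A₁-trivial (retract-LoopsNull c (A₁-trivial⇒LoopsNull (trivial (fun h c))))

module _ {X : Graph} {x₀ : V X} where
  idᶜ : (C : PtCov X x₀) → CovHom C C
  idᶜ C = record { f = idᴳ ; f-pt = ≈-refl (Y C) ; f-tr = λ _ → ≈-refl X }

  _∘ᶜ_ : {C D E : PtCov X x₀} → CovHom D E → CovHom C D → CovHom C E
  _∘ᶜ_ {E = E} g h = record
    { f    = f g ∘ᴳ f h
    ; f-pt = ≈-trans (Y E) (fun-≈ (f g) (f-pt h)) (f-pt g)
    ; f-tr = λ y → ≈-trans X (f-tr g (fun (f h) y)) (f-tr h y)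
    }

-- C and the universal cover are both initial, so C is a retract of it.
universal⇒simplyConnected : ∀ {X x₀} (C : PtCov X x₀) → IsUniversal C → SimplyConnected (Y C)
universal⇒simplyConnected {X} {x₀} C universal =
  retract-simplyConnected (f to) (f back) back∘to≈id simplyConnected
  where
  open UniversalCover X x₀ using (cover; simplyConnected)
  to : CovHom C cover
  to = proj₁ (universal cover)
  back : CovHom cover C
  back = proj₁ (simplyConnected⇒universal cover simplyConnected C)
  back∘to≈id : ∀ y → _≈_ (Y C) (fun (f back) (fun (f to) y)) y
  back∘to≈id y =
    ≈-trans (Y C) (proj₂ (universal C) (back ∘ᶜ to) y) (≈-sym (Y C) (proj₂ (universal C) (idᶜ C) y))

theorem4p30 : ((X : Graph) (x₀ : V X) → Σ (PtCov X x₀) IsUniversal)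
    × ((X : Graph) (x₀ : V X) (C : PtCov X x₀) → IsUniversal C ⇔ SimplyConnected (Y C))
theorem4p30 =
  (λ X x₀ → let open UniversalCover X x₀ in
            cover , simplyConnected⇒universal cover simplyConnected) ,
  (λ X x₀ C → mk⇔ (universal⇒simplyConnected C) (simplyConnected⇒universal C))
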